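{- For $|q|<1$, $$\sum_{n\ge0}q^{2n+1}\frac{(q^{2n+6},q^{2n+2};q^2)_\infty}{(q^{2n+1};q^2)_\infty^2}=\frac{q(1+q+q^2-q^3)}{(1-q)(1-q^3)^2}=\sum_{n\ge0}(n+1)q^{3n+1}\big(n+1+(n+2)q+(n+3)q^2\big),$$ and $$\sum_{n\ge0}q^{2n+1}\frac{(-q^{2n+6},-q^{2n+2};q^2)_\infty}{(q^{2n+1};q^2)_\infty^2}=2q(-q^2;q)_\infty^2(-q^2;q^2)_\infty^2\frac{(1-q+2q^2)(1+q)}{(1+q^2)(1+q^3)^2}-\frac{q(1-q+q^2+q^3)}{(1+q)(1+q^3)^2}$$ $$=2q(-q^2;q)_\infty^2(-q^2;q^2)_\infty^2\frac{(1-q+2q^2)(1+q)}{(1+q^2)(1+q^3)^2}-\sum_{n\ge0}(-1)^n(n+1)q^{3n+1}\big(n+1-(n+2)q+(n+3)q^2\big).$$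
   Context: $(a;q)_\infty=\prod_{j\ge0}(1-aq^j)$ and $(a_1,a_2;q)_\infty=(a_1;q)_\infty(a_2;q)_\infty$. -}

module Defs where

open import Data.Nat using (ℕ; zero; suc; _≡ᵇ_; _∸_)
import Data.Nat as ℕ
open import Data.Integer using (ℤ; +_; -_; _+_; _-_; _*_; 0ℤ; 1ℤ; -1ℤ)
open import Data.Bool using (if_then_else_)
open import Relation.Binary.PropositionalEquality using (_≡_)
open import Data.List using (List; []; _∷_; _++_; [_])

-- Formal power series in q with integer coefficients: N ↦ coefficient of q^N.
FPS : Set
FPS = ℕ → ℤ

Σ≤ : ℕ → (ℕ → ℤ) → ℤ
Σ≤ zero    f = f 0
Σ≤ (suc n) f = Σ≤ n f + f (suc n)

at : List ℤ → ℕ → ℤ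
at []       _       = 0ℤ
at (x ∷ _)  zero    = x
at (_ ∷ xs) (suc n) = at xs n

poly : List ℤ → FPS
poly L N = at L N

mono : ℤ → ℕ → FPS
mono c k N = if N ≡ᵇ k then c else 0ℤ

X^ : ℕ → FPS
X^ k = mono 1ℤ k

infixl 6 _⊕_ _⊖_
infixl 7 _⊛_ _⊘_ _·_

_⊕_ : FPS → FPS → FPS
(f ⊕ g) N = f N + g N

_⊖_ : FPS → FPS → FPS
(f ⊖ g) N = f N - g N

_·_ : ℤ → FPS → FPS
(c · f) N = c * f N

_⊛_ : FPS → FPS → FPS
(f ⊛ g) N = Σ≤ N (λ i → f i * g (N ∸ i))

-- Multiplicative inverse of a series with constant term 1
-- (only used for such series): g₀ = 1, g_{N+1} = - Σ_{k=1}^{N+1} f_k g_{N+1-k}.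
invList : FPS → ℕ → List ℤ
invList f zero    = 1ℤ ∷ []
invList f (suc N) = invList f N ++ [ - Σ≤ N (λ i → f (suc i) * at (invList f N) (N ∸ i)) ]

inv : FPS → FPS
inv f N = at (invList f N) N

-- f / g for g with constant term 1
_⊘_ : FPS → FPS → FPS
f ⊘ g = f ⊛ inv g

Π≤ : ℕ → (ℕ → FPS) → FPS
Π≤ zero    F = F 0
Π≤ (suc n) F = Π≤ n F ⊛ F (suc n)

-- (c q^a ; q^b)_∞ = ∏_{j≥0} (1 - c q^{a+bj}), as a formal power series (b ≥ 1):
-- the coefficient of q^N only depends on the factors j ≤ N.
qPoch : ℤ → ℕ → ℕ → FPS
qPoch c a b N = Π≤ N (λ j → X^ 0 ⊖ mono c (a ℕ.+ b ℕ.* j)) N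

sq : FPS → FPS
sq f = f ⊛ f

-- Σ_{n≥0} F n, for a family where F n has q-adic order ≥ n
-- (so the coefficient of q^N only involves n ≤ N).
sumSeries : (ℕ → FPS) → FPS
sumSeries F N = Σ≤ N (λ n → F n N)

_≈ₛ_ : FPS → FPS → Set
f ≈ₛ g = ∀ N → f N ≡ g N

-- Creative telescoping.  For the two q-series, P n = (c q^(2n+6), c q^(2n+2); q²)∞ / (q^(2n+1); q²)∞²
-- satisfies P n (1 - q^(2n+1))² = (1 - c q^(2n+2)) (1 - c q^(2n+6)) P (n+1).  Hence a polynomial
-- certificate R(q,y) with
--   D(q) q y (1 - c q²y)(1 - c q⁶y) = R(q,y) (1 - c q²y)(1 - c q⁶y) - R(q,q²y) (1 - q y)²
-- gives D(q) q^(2n+1) P n = G n - G (n+1) for G n = R(q,q^(2n)) P n, and since G n → R(q,0)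
-- q-adically, D(q) times the sum is R(q,1) P 0 - R(q,0).  For c = 1, R(q,1) = 0; for c = -1, Euler's
-- identity (q;q²)∞ (-q;q)∞ = 1 turns R(q,1) P 0 into the infinite-product term.  The expansions of the
-- rational functions telescope in the same way against H n = s^n q^(3n) h(q,n), h quadratic in n.
module Submission where

open import Defs
open import Data.Nat using (ℕ)
import Data.Nat as ℕ
open import Data.Integer using (ℤ; +_; -_; 1ℤ; -1ℤ; 0ℤ; _^_)
open import Data.List using ([]; _∷_)
open import Data.Product using (_×_)
open import Algebra.Bundles using (CommutativeRing; RawRing)
open import Data.Bool using (true; false; if_then_else_)
import Data.Bool as Bool
open import Data.Fin using (zero; suc)
import Data.Integer as ℤ
open import Data.Integer using (_+_; _*_; _-_)
import Data.Integer.Properties as ℤP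
open import Data.Integer.Tactic.RingSolver using (solve-∀)
open import Data.List using (List; _++_; [_]; length)
import Data.List.Properties as ListP
open import Data.Maybe using (nothing)
open import Data.Nat using (zero; suc; _∸_; _≤_; _<_; z≤n; s≤s; _≡ᵇ_)
import Algebra.Construct.Pointwise ℕ as Pointwise
import Data.Nat.Properties as ℕP
open import Data.Nat.Tactic.RingSolver using () renaming (solve-∀ to ℕ-solve-∀)
open import Data.Product using (_,_)
open import Data.Sum using (inj₁; inj₂)
open import Data.Vec using (Vec; []; _∷_)
open import Function using (_∘_)
open import Level using (0ℓ)
open import Relation.Binary.Bundles using (Setoid)
open import Relation.Binary.PropositionalEquality hiding ([_])
import Relation.Binary.Reasoning.Setoid as SetoidReasoning
open import Relation.Nullary using (does; yes)
open import Tactic.RingSolver.Core.AlmostCommutativeRing using (AlmostCommutativeRing; fromCommutativeRing)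
open import Tactic.RingSolver.Core.Expression
  renaming (_⊕_ to _:+_; _⊗_ to _:*_; _⊛_ to _:^_; ⊝_ to :-_)
open import Tactic.RingSolver.Core.Polynomial.Parameters using (Homomorphism)

-- Finite sums

Σ≤-cong : ∀ n {f g : ℕ → ℤ} → (∀ i → i ≤ n → f i ≡ g i) → Σ≤ n f ≡ Σ≤ n g
Σ≤-cong zero    f≡g = f≡g 0 z≤n
Σ≤-cong (suc n) f≡g =
  cong₂ _+_ (Σ≤-cong n λ i i≤n → f≡g i (ℕP.m≤n⇒m≤1+n i≤n)) (f≡g (suc n) ℕP.≤-refl)

Σ≤-suc : ∀ n (f : ℕ → ℤ) → Σ≤ (suc n) f ≡ f 0 + Σ≤ n (λ i → f (suc i))
Σ≤-suc zero    f = refl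
Σ≤-suc (suc n) f = trans (cong (_+ f (suc (suc n))) (Σ≤-suc n f)) (ℤP.+-assoc (f 0) _ _)

Σ≤-distrib-+ : ∀ n (f g : ℕ → ℤ) → Σ≤ n (λ i → f i + g i) ≡ Σ≤ n f + Σ≤ n g
Σ≤-distrib-+ zero    f g = refl
Σ≤-distrib-+ (suc n) f g =
  trans (cong (_+ (f (suc n) + g (suc n))) (Σ≤-distrib-+ n f g))
        (swap (Σ≤ n f) (Σ≤ n g) (f (suc n)) (g (suc n)))
  where
  swap : ∀ a b c d → (a + b) + (c + d) ≡ (a + c) + (b + d)
  swap = solve-∀

*-distribˡ-Σ≤ : ∀ n c (f : ℕ → ℤ) → c * Σ≤ n f ≡ Σ≤ n (λ i → c * f i)
*-distribˡ-Σ≤ zero    c f = refl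
*-distribˡ-Σ≤ (suc n) c f =
  trans (ℤP.*-distribˡ-+ c _ _) (cong (_+ (c * f (suc n))) (*-distribˡ-Σ≤ n c f))

Σ≤-zero : ∀ n (f : ℕ → ℤ) → (∀ i → i ≤ n → f i ≡ 0ℤ) → Σ≤ n f ≡ 0ℤ
Σ≤-zero zero    f f≡0 = f≡0 0 z≤n
Σ≤-zero (suc n) f f≡0 =
  cong₂ _+_ (Σ≤-zero n f λ i i≤n → f≡0 i (ℕP.m≤n⇒m≤1+n i≤n)) (f≡0 (suc n) ℕP.≤-refl)

Σ≤-extend : ∀ {k n} (f : ℕ → ℤ) → k ≤ n → (∀ i → k < i → f i ≡ 0ℤ) → Σ≤ k f ≡ Σ≤ n f
Σ≤-extend {n = zero}  f z≤n f≡0 = refl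
Σ≤-extend {k} {suc n} f k≤1+n f≡0 with ℕP.m≤n⇒m<n∨m≡n k≤1+n
... | inj₂ refl = refl
... | inj₁ k<1+n = begin
  Σ≤ k f                 ≡⟨ Σ≤-extend f (ℕP.≤-pred k<1+n) f≡0 ⟩
  Σ≤ n f                 ≡⟨ ℤP.+-identityʳ _ ⟨
  Σ≤ n f + 0ℤ            ≡⟨ cong (λ z → Σ≤ n f + z) (f≡0 (suc n) k<1+n) ⟨
  Σ≤ (suc n) f           ∎
  where open ≡-Reasoning

-- The ring of formal power series

0ₛ : FPS
0ₛ _ = 0ℤ

infix 8 ⊝_
⊝_ : FPS → FPS
(⊝ f) N = - f N

const : ℤ → FPS
const c = mono c 0

shift : FPS → FPS
shift f N = f (suc N)

≈ₛ-setoid : Setoid 0ℓ 0ℓ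
≈ₛ-setoid = record { Carrier = FPS ; _≈_ = _≈ₛ_ ; isEquivalence = Pointwise.isEquivalence isEquivalence }

open Setoid ≈ₛ-setoid using () renaming (refl to ≈ₛ-refl; reflexive to ≈ₛ-reflexive; sym to ≈ₛ-sym; trans to ≈ₛ-trans)

module ≈ₛ-Reasoning = SetoidReasoning ≈ₛ-setoid

⊛-cong : ∀ {f f′ g g′} → f ≈ₛ f′ → g ≈ₛ g′ → (f ⊛ g) ≈ₛ (f′ ⊛ g′)
⊛-cong f≈ g≈ N = Σ≤-cong N (λ i _ → cong₂ _*_ (f≈ i) (g≈ (N ∸ i)))

⊛-congˡ : ∀ f {g g′} → g ≈ₛ g′ → (f ⊛ g) ≈ₛ (f ⊛ g′)
⊛-congˡ f = ⊛-cong {f} ≈ₛ-refl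

⊛-congʳ : ∀ g {f f′} → f ≈ₛ f′ → (f ⊛ g) ≈ₛ (f′ ⊛ g)
⊛-congʳ g f≈f′ = ⊛-cong {g = g} f≈f′ ≈ₛ-refl

⊕-cong : ∀ {f f′ g g′} → f ≈ₛ f′ → g ≈ₛ g′ → (f ⊕ g) ≈ₛ (f′ ⊕ g′)
⊕-cong f≈f′ g≈g′ N = cong₂ _+_ (f≈f′ N) (g≈g′ N)

⊖-cong : ∀ {f f′ g g′} → f ≈ₛ f′ → g ≈ₛ g′ → (f ⊖ g) ≈ₛ (f′ ⊖ g′)
⊖-cong f≈f′ g≈g′ N = cong₂ _-_ (f≈f′ N) (g≈g′ N)

⊖-congˡ : ∀ f {g g′} → g ≈ₛ g′ → (f ⊖ g) ≈ₛ (f ⊖ g′)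
⊖-congˡ f g≈g′ N = cong (λ z → f N - z) (g≈g′ N)

⊖-congʳ : ∀ g {f f′} → f ≈ₛ f′ → (f ⊖ g) ≈ₛ (f′ ⊖ g)
⊖-congʳ g f≈f′ N = cong (λ z → z - g N) (f≈f′ N)

⊛-suc : ∀ f g N → (f ⊛ g) (suc N) ≡ f 0 * g (suc N) + (shift f ⊛ g) N
⊛-suc f g N = Σ≤-suc N _

⊛-sucʳ : ∀ f g N → (f ⊛ g) (suc N) ≡ (f ⊛ shift g) N + f (suc N) * g 0
⊛-sucʳ f g N = cong₂ _+_ (Σ≤-cong N λ i i≤N → cong (λ k → f i * g k) (ℕP.+-∸-assoc 1 i≤N))
                         (cong (λ k → f (suc N) * g k) (ℕP.n∸n≡0 N))

⊛-comm : ∀ f g → (f ⊛ g) ≈ₛ (g ⊛ f)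
⊛-comm f g zero    = ℤP.*-comm (f 0) (g 0)
⊛-comm f g (suc N) = begin
  (f ⊛ g) (suc N)                    ≡⟨ ⊛-sucʳ f g N ⟩
  (f ⊛ shift g) N + f (suc N) * g 0  ≡⟨ cong₂ _+_ (⊛-comm f (shift g) N) (ℤP.*-comm (f (suc N)) (g 0)) ⟩
  (shift g ⊛ f) N + g 0 * f (suc N)  ≡⟨ ℤP.+-comm ((shift g ⊛ f) N) _ ⟩
  g 0 * f (suc N) + (shift g ⊛ f) N  ≡⟨ ⊛-suc g f N ⟨
  (g ⊛ f) (suc N)                    ∎
  where open ≡-Reasoning

·-⊛-assoc : ∀ c f g → ((c · f) ⊛ g) ≈ₛ (c · (f ⊛ g))
·-⊛-assoc c f g N = trans (Σ≤-cong N λ i _ → ℤP.*-assoc c (f i) _) (sym (*-distribˡ-Σ≤ N c _))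

⊛-distribˡ-⊕ : ∀ f g h → (f ⊛ (g ⊕ h)) ≈ₛ ((f ⊛ g) ⊕ (f ⊛ h))
⊛-distribˡ-⊕ f g h N = trans (Σ≤-cong N λ i _ → ℤP.*-distribˡ-+ (f i) _ _) (Σ≤-distrib-+ N _ _)

⊛-distribʳ-⊕ : ∀ f g h → ((g ⊕ h) ⊛ f) ≈ₛ ((g ⊛ f) ⊕ (h ⊛ f))
⊛-distribʳ-⊕ f g h N = trans (Σ≤-cong N λ i _ → ℤP.*-distribʳ-+ (f (N ∸ i)) (g i) _) (Σ≤-distrib-+ N _ _)

shift-⊛ : ∀ f g → shift (f ⊛ g) ≈ₛ ((f 0 · shift g) ⊕ (shift f ⊛ g))
shift-⊛ f g = ⊛-suc f g

⊛-assoc : ∀ f g h → ((f ⊛ g) ⊛ h) ≈ₛ (f ⊛ (g ⊛ h))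
⊛-assoc f g h zero    = ℤP.*-assoc (f 0) (g 0) (h 0)
⊛-assoc f g h (suc N) = begin
  ((f ⊛ g) ⊛ h) (suc N)
    ≡⟨ ⊛-suc (f ⊛ g) h N ⟩
  a * b * h (suc N) + (shift (f ⊛ g) ⊛ h) N
    ≡⟨ cong (λ z → a * b * h (suc N) + z)
            (trans (⊛-congʳ h (shift-⊛ f g) N) (⊛-distribʳ-⊕ h (f 0 · shift g) (shift f ⊛ g) N)) ⟩
  a * b * h (suc N) + (((a · shift g) ⊛ h) N + ((shift f ⊛ g) ⊛ h) N)
    ≡⟨ cong (λ z → a * b * h (suc N) + z) (cong₂ _+_ (·-⊛-assoc a (shift g) h N) (⊛-assoc (shift f) g h N)) ⟩
  a * b * h (suc N) + (a * (shift g ⊛ h) N + (shift f ⊛ (g ⊛ h)) N)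
    ≡⟨ regroup a b (h (suc N)) _ _ ⟩
  a * (b * h (suc N) + (shift g ⊛ h) N) + (shift f ⊛ (g ⊛ h)) N
    ≡⟨ cong (λ z → a * z + (shift f ⊛ (g ⊛ h)) N) (⊛-suc g h N) ⟨
  a * (g ⊛ h) (suc N) + (shift f ⊛ (g ⊛ h)) N
    ≡⟨ ⊛-suc f (g ⊛ h) N ⟨
  (f ⊛ (g ⊛ h)) (suc N) ∎
  where
  open ≡-Reasoning
  a = f 0
  b = g 0
  regroup : ∀ a b c d e → a * b * c + (a * d + e) ≡ a * (b * c + d) + e
  regroup = solve-∀

⊛-zeroˡ : ∀ g → (0ₛ ⊛ g) ≈ₛ 0ₛ
⊛-zeroˡ g N = Σ≤-zero N _ (λ _ _ → refl)

⊛-identityˡ : ∀ g → (X^ 0 ⊛ g) ≈ₛ g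
⊛-identityˡ g zero    = ℤP.*-identityˡ (g 0)
⊛-identityˡ g (suc N) = begin
  (X^ 0 ⊛ g) (suc N)                     ≡⟨ ⊛-suc (X^ 0) g N ⟩
  1ℤ * g (suc N) + (shift (X^ 0) ⊛ g) N  ≡⟨ cong₂ _+_ (ℤP.*-identityˡ (g (suc N))) (⊛-zeroˡ g N) ⟩
  g (suc N) + 0ℤ                         ≡⟨ ℤP.+-identityʳ _ ⟩
  g (suc N)                              ∎
  where open ≡-Reasoning

⊛-identityʳ : ∀ g → (g ⊛ X^ 0) ≈ₛ g
⊛-identityʳ g = ≈ₛ-trans (⊛-comm g (X^ 0)) (⊛-identityˡ g)

fps-commutativeRing : CommutativeRing _ _
fps-commutativeRing = record
  { Carrier = FPS
  ; _≈_ = _≈ₛ_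
  ; _+_ = _⊕_
  ; _*_ = _⊛_
  ; -_ = ⊝_
  ; 0# = 0ₛ
  ; 1# = X^ 0
  ; isCommutativeRing = record
    { isRing = record
      { +-isAbelianGroup = Pointwise.isAbelianGroup ℤP.+-0-isAbelianGroup
      ; *-cong = ⊛-cong
      ; *-assoc = ⊛-assoc
      ; *-identity = ⊛-identityˡ , ⊛-identityʳ
      ; distrib = ⊛-distribˡ-⊕ , ⊛-distribʳ-⊕
      }
    ; *-comm = ⊛-comm
    }
  }

const-⊛ : ∀ c g → (const c ⊛ g) ≈ₛ (c · g)
const-⊛ c g zero    = refl
const-⊛ c g (suc N) = begin
  (const c ⊛ g) (suc N)            ≡⟨ ⊛-suc (const c) g N ⟩
  c * g (suc N) + (0ₛ ⊛ g) N       ≡⟨ cong (λ z → c * g (suc N) + z) (⊛-zeroˡ g N) ⟩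
  c * g (suc N) + 0ℤ               ≡⟨ ℤP.+-identityʳ _ ⟩
  c * g (suc N)                    ∎
  where open ≡-Reasoning

const-+ : ∀ a b → const (a + b) ≈ₛ (const a ⊕ const b)
const-+ a b zero    = refl
const-+ a b (suc N) = refl

const-+ℕ : ∀ n k → const (+ (n ℕ.+ k)) ≈ₛ (const (+ n) ⊕ const (+ k))
const-+ℕ n k = ≈ₛ-trans (≈ₛ-reflexive (cong const (ℤP.pos-+ n k))) (const-+ (+ n) (+ k))

const-* : ∀ a b → const (a * b) ≈ₛ (const a ⊛ const b)
const-* a b N = sym (trans (const-⊛ a (const b) N) (scaled N))
  where
  scaled : ∀ N → a * const b N ≡ const (a * b) N
  scaled zero    = refl
  scaled (suc N) = ℤP.*-zeroʳ a

0ₛ≈const0 : 0ₛ ≈ₛ const 0ℤ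
0ₛ≈const0 zero    = refl
0ₛ≈const0 (suc N) = refl

open import Algebra.Properties.CommutativeSemigroup (CommutativeRing.*-commutativeSemigroup fps-commutativeRing)
  using (interchange; xy∙z≈xz∙y)

-- Tactic.RingSolver.NonReflective takes its coefficients from the ring itself; here they are
-- integers, embedded by const, so that normal forms of concrete identities are compared by evaluation.

fps-almostCommutativeRing : AlmostCommutativeRing _ _
fps-almostCommutativeRing = fromCommutativeRing fps-commutativeRing (λ _ → nothing)

const-homomorphism : Homomorphism _ _ _ _
const-homomorphism = record
  { from = record { rawRing = CommutativeRing.rawRing ℤP.+-*-commutativeRing ; isZero = λ c → does (c ℤ.≟ 0ℤ) }
  ; to = fps-almostCommutativeRing
  ; morphism = record
    { ⟦_⟧    = const
    ; +-homo = const-+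
    ; *-homo = const-*
    ; -‿homo = λ { a zero → refl ; a (suc N) → refl }
    ; 0-homo = λ { zero → refl ; (suc N) → refl }
    ; 1-homo = ≈ₛ-refl
    }
  ; Zero-C⟶Zero-R = const-zero
  }
  where
  const-zero : ∀ c → Bool.T (does (c ℤ.≟ 0ℤ)) → 0ₛ ≈ₛ const c
  const-zero c _ with c ℤ.≟ 0ℤ
  ... | yes refl = λ { zero → refl ; (suc N) → refl }

open Eval (AlmostCommutativeRing.rawRing fps-almostCommutativeRing) const
open import Algebra.Definitions.RawSemiring (RawRing.rawSemiring (AlmostCommutativeRing.rawRing fps-almostCommutativeRing))
  using (_^′_)

module IntegerSolver where

  open import Algebra.Properties.Semiring.Exp.TCOptimised (AlmostCommutativeRing.semiring fps-almostCommutativeRing)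
    using (^-congˡ)
  open import Tactic.RingSolver.Core.Polynomial.Base (Homomorphism.from const-homomorphism)
  open import Tactic.RingSolver.Core.Polynomial.Semantics const-homomorphism renaming (⟦_⟧ to ⟦_⟧ₚ)
  open import Tactic.RingSolver.Core.Polynomial.Homomorphism const-homomorphism

  norm : ∀ {n} → Expr ℤ n → Poly n
  norm (Κ c)    = κ c
  norm (Ι i)    = ι i
  norm (x :+ y) = norm x ⊞ norm y
  norm (x :* y) = norm x ⊠ norm y
  norm (:- x)   = ⊟ norm x
  norm (x :^ i) = norm x ⊡ i

  norm-correct : ∀ {n} (e : Expr ℤ n) ρ → ⟦ norm e ⟧ₚ ρ ≈ₛ ⟦ e ⟧ ρ
  norm-correct (Κ c)    ρ = κ-hom c ρ
  norm-correct (Ι i)    ρ = ι-hom i ρ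
  norm-correct (x :+ y) ρ = ≈ₛ-trans (⊞-hom (norm x) (norm y) ρ) (⊕-cong (norm-correct x ρ) (norm-correct y ρ))
  norm-correct (x :* y) ρ = ≈ₛ-trans (⊠-hom (norm x) (norm y) ρ) (⊛-cong (norm-correct x ρ) (norm-correct y ρ))
  norm-correct (:- x)   ρ = ≈ₛ-trans (⊟-hom (norm x) ρ) (λ N → cong -_ (norm-correct x ρ N))
  norm-correct (x :^ i) ρ = ≈ₛ-trans (⊡-hom (norm x) i ρ) (^-congˡ i (norm-correct x ρ))

  prove : ∀ {n} (e₁ e₂ : Expr ℤ n) → norm e₁ ≡ norm e₂ → ∀ ρ → ⟦ e₁ ⟧ ρ ≈ₛ ⟦ e₂ ⟧ ρ
  prove e₁ e₂ e₁≡e₂ ρ =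
    ≈ₛ-trans (≈ₛ-sym (norm-correct e₁ ρ))
             (≈ₛ-trans (≈ₛ-reflexive (cong (λ p → ⟦ p ⟧ₚ ρ) e₁≡e₂)) (norm-correct e₂ ρ))

open IntegerSolver using (norm; prove)

infixl 6 _:-_
_:-_ : ∀ {n} → Expr ℤ n → Expr ℤ n → Expr ℤ n
x :- y = x :+ :- y

⊛-distribʳ-⊖ : ∀ f g h → ((f ⊖ g) ⊛ h) ≈ₛ ((f ⊛ h) ⊖ (g ⊛ h))
⊛-distribʳ-⊖ f g h = prove ((𝐟 :- 𝐠) :* 𝐡) (𝐟 :* 𝐡 :- 𝐠 :* 𝐡) refl (f ∷ g ∷ h ∷ [])
  where
  𝐟 𝐠 𝐡 : Expr ℤ 3
  𝐟 = Ι zero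
  𝐠 = Ι (suc zero)
  𝐡 = Ι (suc (suc zero))

-- Monomials and congruences modulo q^K

q : FPS
q = X^ 1

q-⊛-suc : ∀ g N → (q ⊛ g) (suc N) ≡ g N
q-⊛-suc g N = trans (⊛-suc q g N) (trans (ℤP.+-identityˡ _) (⊛-identityˡ g N))

X^-suc : ∀ k → X^ (suc k) ≈ₛ (q ⊛ X^ k)
X^-suc k zero    = refl
X^-suc k (suc N) = sym (q-⊛-suc (X^ k) N)

X^-+ : ∀ a b → X^ (a ℕ.+ b) ≈ₛ (X^ a ⊛ X^ b)
X^-+ zero    b = ≈ₛ-sym (⊛-identityˡ (X^ b))
X^-+ (suc a) b = begin
  X^ (suc a ℕ.+ b)        ≈⟨ X^-suc (a ℕ.+ b) ⟩
  q ⊛ X^ (a ℕ.+ b)        ≈⟨ ⊛-congˡ q (X^-+ a b) ⟩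
  q ⊛ (X^ a ⊛ X^ b)       ≈⟨ ⊛-assoc q (X^ a) (X^ b) ⟨
  (q ⊛ X^ a) ⊛ X^ b       ≈⟨ ⊛-congʳ (X^ b) (X^-suc a) ⟨
  X^ (suc a) ⊛ X^ b       ∎
  where open ≈ₛ-Reasoning

X^≈q^′ : ∀ k → X^ k ≈ₛ (q ^′ k)
X^≈q^′ zero          = ≈ₛ-refl
X^≈q^′ (suc zero)    = ≈ₛ-refl
X^≈q^′ (suc (suc k)) =
  ≈ₛ-trans (X^-suc (suc k)) (≈ₛ-trans (⊛-comm q (X^ (suc k))) (⊛-congʳ q (X^≈q^′ (suc k))))

X^-+-q^′ : ∀ m k → X^ (m ℕ.+ k) ≈ₛ (q ^′ k ⊛ X^ m)
X^-+-q^′ m k = ≈ₛ-trans (X^-+ m k) (≈ₛ-trans (⊛-comm (X^ m) (X^ k)) (⊛-congʳ (X^ m) (X^≈q^′ k)))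

mono≈const⊛X^ : ∀ c k → mono c k ≈ₛ (const c ⊛ X^ k)
mono≈const⊛X^ c k N = trans (if-scale (N ≡ᵇ k)) (sym (const-⊛ c (X^ k) N))
  where
  if-scale : ∀ b → (if b then c else 0ℤ) ≡ c * (if b then 1ℤ else 0ℤ)
  if-scale true  = sym (ℤP.*-identityʳ c)
  if-scale false = sym (ℤP.*-zeroʳ c)

infix 4 _≈[_]_
_≈[_]_ : FPS → ℕ → FPS → Set
f ≈[ K ] g = ∀ N → N < K → f N ≡ g N

≈[]-setoid : ℕ → Setoid 0ℓ 0ℓ
≈[]-setoid K = record
  { Carrier = FPS
  ; _≈_ = _≈[ K ]_
  ; isEquivalence = record
    { refl  = λ _ _ → refl
    ; sym   = λ f≈g N N<K → sym (f≈g N N<K)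
    ; trans = λ f≈g g≈h N N<K → trans (f≈g N N<K) (g≈h N N<K)
    }
  }

module ≈[]-Reasoning (K : ℕ) = SetoidReasoning (≈[]-setoid K)

≈ₛ⇒≈[] : ∀ {f g} K → f ≈ₛ g → f ≈[ K ] g
≈ₛ⇒≈[] K f≈g N _ = f≈g N

≈[]⇒≈ₛ : ∀ {f g} → (∀ M → f ≈[ suc M ] g) → f ≈ₛ g
≈[]⇒≈ₛ f≈g N = f≈g N N ℕP.≤-refl

≈[]-weaken : ∀ {f g K K′} → K′ ≤ K → f ≈[ K ] g → f ≈[ K′ ] g
≈[]-weaken K′≤K f≈g N N<K′ = f≈g N (ℕP.<-≤-trans N<K′ K′≤K)

⊛-cong-≈[] : ∀ {f f′ g g′ K} → f ≈[ K ] f′ → g ≈[ K ] g′ → (f ⊛ g) ≈[ K ] (f′ ⊛ g′)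
⊛-cong-≈[] f≈ g≈ N N<K = Σ≤-cong N λ i i≤N →
  cong₂ _*_ (f≈ i (ℕP.≤-<-trans i≤N N<K)) (g≈ (N ∸ i) (ℕP.≤-<-trans (ℕP.m∸n≤m N i) N<K))

⊛-≈[]-1 : ∀ {f g K} → f ≈[ K ] X^ 0 → g ≈[ K ] X^ 0 → (f ⊛ g) ≈[ K ] X^ 0
⊛-≈[]-1 f≈1 g≈1 N N<K = trans (⊛-cong-≈[] f≈1 g≈1 N N<K) (⊛-identityˡ (X^ 0) N)

⊖-cong-≈[] : ∀ {f f′ g g′ K} → f ≈[ K ] f′ → g ≈[ K ] g′ → (f ⊖ g) ≈[ K ] (f′ ⊖ g′)
⊖-cong-≈[] f≈ g≈ N N<K = cong₂ _-_ (f≈ N N<K) (g≈ N N<K)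

mono-≈[]-0 : ∀ c k → mono c k ≈[ k ] 0ₛ
mono-≈[]-0 c (suc k) zero    _         = refl
mono-≈[]-0 c (suc k) (suc N) (s≤s N<k) = mono-≈[]-0 c k N N<k

⊛-≈[]-0ˡ : ∀ {f K} g → f ≈[ K ] 0ₛ → (f ⊛ g) ≈[ K ] 0ₛ
⊛-≈[]-0ˡ g f≈0 N N<K = trans (⊛-cong-≈[] {g = g} f≈0 (λ _ _ → refl) N N<K) (⊛-zeroˡ g N)

⊛-≈[]-0ʳ : ∀ f {g K} → g ≈[ K ] 0ₛ → (f ⊛ g) ≈[ K ] 0ₛ
⊛-≈[]-0ʳ f {g} g≈0 N N<K = trans (⊛-comm f g N) (⊛-≈[]-0ˡ f g≈0 N N<K)

·-≈[]-0 : ∀ c {f K} → f ≈[ K ] 0ₛ → (c · f) ≈[ K ] 0ₛ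
·-≈[]-0 c f≈0 N N<K = trans (cong (c *_) (f≈0 N N<K)) (ℤP.*-zeroʳ c)

-- Reciprocals

at-++ : ∀ (xs : List ℤ) y k → k < length xs → at (xs ++ [ y ]) k ≡ at xs k
at-++ (x ∷ xs) y zero    _         = refl
at-++ (x ∷ xs) y (suc k) (s≤s k<n) = at-++ xs y k k<n

at-++-length : ∀ (xs : List ℤ) y → at (xs ++ [ y ]) (length xs) ≡ y
at-++-length []       y = refl
at-++-length (x ∷ xs) y = at-++-length xs y

length-invList : ∀ f N → length (invList f N) ≡ suc N
length-invList f zero    = refl
length-invList f (suc N) =
  trans (ListP.length-++ (invList f N)) (trans (cong (ℕ._+ 1) (length-invList f N)) (ℕP.+-comm (suc N) 1))

invList-stable : ∀ f {N k} → k ≤ N → at (invList f N) k ≡ inv f k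
invList-stable f {zero}  z≤n = refl
invList-stable f {suc N} k≤1+N with ℕP.m≤n⇒m<n∨m≡n k≤1+N
... | inj₂ refl       = refl
... | inj₁ (s≤s k≤N) =
  trans (at-++ (invList f N) _ _ (subst (_ <_) (sym (length-invList f N)) (s≤s k≤N))) (invList-stable f k≤N)

inv-suc : ∀ f N → inv f (suc N) ≡ - (shift f ⊛ inv f) N
inv-suc f N = trans (subst (λ k → at (invList f N ++ [ y ]) k ≡ y) (length-invList f N) (at-++-length (invList f N) y))
                    (cong -_ (Σ≤-cong N λ i _ → cong (f (suc i) *_) (invList-stable f (ℕP.m∸n≤m N i))))
  where y = - Σ≤ N (λ i → f (suc i) * at (invList f N) (N ∸ i))

⊛-inverseʳ : ∀ f → f 0 ≡ 1ℤ → (f ⊛ inv f) ≈ₛ X^ 0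
⊛-inverseʳ f f₀≡1 zero    = cong (_* 1ℤ) f₀≡1
⊛-inverseʳ f f₀≡1 (suc N) = begin
  (f ⊛ inv f) (suc N)                    ≡⟨ ⊛-suc f (inv f) N ⟩
  f 0 * inv f (suc N) + s                ≡⟨ cong₂ (λ a b → a * b + s) f₀≡1 (inv-suc f N) ⟩
  1ℤ * - s + s                           ≡⟨ cong (_+ s) (ℤP.*-identityˡ (- s)) ⟩
  - s + s                                ≡⟨ ℤP.+-inverseˡ s ⟩
  0ℤ                                     ∎
  where
  open ≡-Reasoning
  s = (shift f ⊛ inv f) N

⊘-⊛-cancel : ∀ f {g} → g 0 ≡ 1ℤ → ((f ⊘ g) ⊛ g) ≈ₛ f
⊘-⊛-cancel f {g} g₀≡1 = begin
  (f ⊛ inv g) ⊛ g    ≈⟨ ⊛-assoc f (inv g) g ⟩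
  f ⊛ (inv g ⊛ g)    ≈⟨ ⊛-congˡ f (≈ₛ-trans (⊛-comm (inv g) g) (⊛-inverseʳ g g₀≡1)) ⟩
  f ⊛ X^ 0           ≈⟨ ⊛-identityʳ f ⟩
  f                  ∎
  where open ≈ₛ-Reasoning

⊛-⊘-cancel : ∀ f {g} → g 0 ≡ 1ℤ → ((f ⊛ g) ⊘ g) ≈ₛ f
⊛-⊘-cancel f {g} g₀≡1 = begin
  (f ⊛ g) ⊛ inv g    ≈⟨ ⊛-assoc f g (inv g) ⟩
  f ⊛ (g ⊛ inv g)    ≈⟨ ⊛-congˡ f (⊛-inverseʳ g g₀≡1) ⟩
  f ⊛ X^ 0           ≈⟨ ⊛-identityʳ f ⟩
  f                  ∎
  where open ≈ₛ-Reasoning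

⊛-cancelʳ : ∀ g {f h} → g 0 ≡ 1ℤ → (f ⊛ g) ≈ₛ (h ⊛ g) → f ≈ₛ h
⊛-cancelʳ g {f} {h} g₀≡1 fg≈hg =
  ≈ₛ-trans (≈ₛ-sym (⊛-⊘-cancel f g₀≡1)) (≈ₛ-trans (⊛-congʳ (inv g) fg≈hg) (⊛-⊘-cancel h g₀≡1))

⊘-unique : ∀ g {f h} → g 0 ≡ 1ℤ → (f ⊛ g) ≈ₛ h → f ≈ₛ (h ⊘ g)
⊘-unique g {f} g₀≡1 fg≈h = ≈ₛ-trans (≈ₛ-sym (⊛-⊘-cancel f g₀≡1)) (⊛-congʳ (inv g) fg≈h)

inv-≈[]-1 : ∀ {g K} → g 0 ≡ 1ℤ → g ≈[ K ] X^ 0 → inv g ≈[ K ] X^ 0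
inv-≈[]-1 {g} {K} g₀≡1 g≈1 = begin
  inv g             ≈⟨ ≈ₛ⇒≈[] K (⊛-identityʳ (inv g)) ⟨
  inv g ⊛ X^ 0      ≈⟨ ⊛-cong-≈[] {inv g} (λ _ _ → refl) g≈1 ⟨
  inv g ⊛ g         ≈⟨ ≈ₛ⇒≈[] K (≈ₛ-trans (⊛-comm (inv g) g) (⊛-inverseʳ g g₀≡1)) ⟩
  X^ 0              ∎
  where open ≈[]-Reasoning K

⊘-shift : ∀ {a a′ α b b′ β} → b 0 ≡ 1ℤ → b′ 0 ≡ 1ℤ
  → a ≈ₛ (α ⊛ a′) → b ≈ₛ (β ⊛ b′) → ((a ⊘ b) ⊛ β) ≈ₛ (α ⊛ (a′ ⊘ b′))
⊘-shift {a} {a′} {α} {b} {b′} {β} b₀≡1 b′₀≡1 a≈ b≈ = ⊛-cancelʳ b′ b′₀≡1 (begin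
  ((a ⊘ b) ⊛ β) ⊛ b′      ≈⟨ ⊛-assoc (a ⊘ b) β b′ ⟩
  (a ⊘ b) ⊛ (β ⊛ b′)      ≈⟨ ⊛-congˡ (a ⊘ b) b≈ ⟨
  (a ⊘ b) ⊛ b             ≈⟨ ⊘-⊛-cancel a b₀≡1 ⟩
  a                       ≈⟨ a≈ ⟩
  α ⊛ a′                  ≈⟨ ⊛-congˡ α (⊘-⊛-cancel a′ b′₀≡1) ⟨
  α ⊛ ((a′ ⊘ b′) ⊛ b′)    ≈⟨ ⊛-assoc α (a′ ⊘ b′) b′ ⟨
  (α ⊛ (a′ ⊘ b′)) ⊛ b′    ∎)
  where open ≈ₛ-Reasoning

⊘-inverse : ∀ f {g g′} → g 0 ≡ 1ℤ → (g ⊛ g′) ≈ₛ X^ 0 → (f ⊘ g) ≈ₛ (f ⊛ g′)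
⊘-inverse f {g} {g′} g₀≡1 gg′≈1 = begin
  f ⊘ g                  ≈⟨ ⊛-identityʳ (f ⊘ g) ⟨
  (f ⊘ g) ⊛ X^ 0         ≈⟨ ⊛-congˡ (f ⊘ g) gg′≈1 ⟨
  (f ⊘ g) ⊛ (g ⊛ g′)     ≈⟨ ⊛-assoc (f ⊘ g) g g′ ⟨
  ((f ⊘ g) ⊛ g) ⊛ g′     ≈⟨ ⊛-congʳ g′ (⊘-⊛-cancel f g₀≡1) ⟩
  f ⊛ g′                 ∎
  where open ≈ₛ-Reasoning

-- Infinite products and Euler's identity

qFactor : ℤ → ℕ → FPS
qFactor c k = X^ 0 ⊖ mono c k

qFactor≈ : ∀ c k → qFactor c k ≈ₛ (X^ 0 ⊖ (const c ⊛ X^ k))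
qFactor≈ c k N = cong (λ z → X^ 0 N - z) (mono≈const⊛X^ c k N)

qFactor-≈[]-1 : ∀ c k → qFactor c k ≈[ k ] X^ 0
qFactor-≈[]-1 c k N N<k = trans (cong (λ z → X^ 0 N - z) (mono-≈[]-0 c k N N<k)) (ℤP.+-identityʳ (X^ 0 N))

Π∞ : (ℕ → FPS) → FPS
Π∞ F N = Π≤ N F N

Convergent : (ℕ → FPS) → Set
Convergent F = ∀ j → F j ≈[ suc j ] X^ 0

Π≤-cong : ∀ n {F G : ℕ → FPS} → (∀ j → F j ≈ₛ G j) → Π≤ n F ≈ₛ Π≤ n G
Π≤-cong zero    F≈G = F≈G 0
Π≤-cong (suc n) F≈G = ⊛-cong (Π≤-cong n F≈G) (F≈G (suc n))

Π≤-suc : ∀ n (F : ℕ → FPS) → Π≤ (suc n) F ≈ₛ (F 0 ⊛ Π≤ n (F ∘ suc))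
Π≤-suc zero    F = ≈ₛ-refl
Π≤-suc (suc n) F =
  ≈ₛ-trans (⊛-congʳ (F (suc (suc n))) (Π≤-suc n F)) (⊛-assoc (F 0) (Π≤ n (F ∘ suc)) (F (suc (suc n))))

Π≤-⊛ : ∀ n (F G : ℕ → FPS) → (Π≤ n F ⊛ Π≤ n G) ≈ₛ Π≤ n (λ j → F j ⊛ G j)
Π≤-⊛ zero    F G = ≈ₛ-refl
Π≤-⊛ (suc n) F G = ≈ₛ-trans (interchange (Π≤ n F) (F (suc n)) (Π≤ n G) (G (suc n)))
                            (⊛-congʳ (F (suc n) ⊛ G (suc n)) (Π≤-⊛ n F G))

Π≤-≈[]-1 : ∀ n {K} (F : ℕ → FPS) → (∀ j → F j ≈[ K ] X^ 0) → Π≤ n F ≈[ K ] X^ 0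
Π≤-≈[]-1 zero    F F≈1 = F≈1 0
Π≤-≈[]-1 (suc n) F F≈1 = ⊛-≈[]-1 (Π≤-≈[]-1 n F F≈1) (F≈1 (suc n))

Π≤-stable : ∀ {F} → Convergent F → ∀ {N M} → N ≤ M → Π≤ M F ≈[ suc N ] Π≤ N F
Π≤-stable F-conv {M = zero} z≤n = λ _ _ → refl
Π≤-stable {F} F-conv {N} {suc M} N≤1+M with ℕP.m≤n⇒m<n∨m≡n N≤1+M
... | inj₂ refl = λ _ _ → refl
... | inj₁ (s≤s N≤M) = λ K K<1+N →
  trans (⊛-cong-≈[] {Π≤ M F} (λ _ _ → refl) (≈[]-weaken (s≤s (ℕP.m≤n⇒m≤1+n N≤M)) (F-conv (suc M)))
                    K K<1+N)
        (trans (⊛-identityʳ (Π≤ M F) K) (Π≤-stable F-conv N≤M K K<1+N))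

Π∞-≈[]-Π≤ : ∀ {F} → Convergent F → ∀ M → Π∞ F ≈[ suc M ] Π≤ M F
Π∞-≈[]-Π≤ F-conv M N (s≤s N≤M) = sym (Π≤-stable F-conv N≤M N ℕP.≤-refl)

Π∞-cong : ∀ {F G} → (∀ j → F j ≈ₛ G j) → Π∞ F ≈ₛ Π∞ G
Π∞-cong F≈G N = Π≤-cong N F≈G N

Π∞-≈[]-1 : ∀ {K} F → (∀ j → F j ≈[ K ] X^ 0) → Π∞ F ≈[ K ] X^ 0
Π∞-≈[]-1 F F≈1 N = Π≤-≈[]-1 N F F≈1 N

Convergent-∘ : ∀ {F} → Convergent F → ∀ {σ : ℕ → ℕ} → (∀ j → j ≤ σ j) → Convergent (F ∘ σ)
Convergent-∘ F-conv {σ} j≤σj j = ≈[]-weaken (s≤s (j≤σj j)) (F-conv (σ j))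

Π∞-suc : ∀ {F} → Convergent F → Π∞ F ≈ₛ (F 0 ⊛ Π∞ (F ∘ suc))
Π∞-suc {F} F-conv = ≈[]⇒≈ₛ approx
  where
  approx : ∀ M → Π∞ F ≈[ suc M ] (F 0 ⊛ Π∞ (F ∘ suc))
  approx M = begin
    Π∞ F                    ≈⟨ ≈[]-weaken (ℕP.n≤1+n (suc M)) (Π∞-≈[]-Π≤ F-conv (suc M)) ⟩
    Π≤ (suc M) F            ≈⟨ ≈ₛ⇒≈[] (suc M) (Π≤-suc M F) ⟩
    F 0 ⊛ Π≤ M (F ∘ suc)    ≈⟨ ⊛-cong-≈[] {F 0} (λ _ _ → refl) (Π∞-≈[]-Π≤ (Convergent-∘ F-conv ℕP.n≤1+n) M) ⟨
    F 0 ⊛ Π∞ (F ∘ suc)      ∎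
    where open ≈[]-Reasoning (suc M)

Convergent-⊛ : ∀ {F G} → Convergent F → Convergent G → Convergent (λ j → F j ⊛ G j)
Convergent-⊛ F-conv G-conv j = ⊛-≈[]-1 (F-conv j) (G-conv j)

Π∞-⊛ : ∀ {F G} → Convergent F → Convergent G → (Π∞ F ⊛ Π∞ G) ≈ₛ Π∞ (λ j → F j ⊛ G j)
Π∞-⊛ {F} {G} F-conv G-conv = ≈[]⇒≈ₛ approx
  where
  approx : ∀ M → (Π∞ F ⊛ Π∞ G) ≈[ suc M ] Π∞ (λ j → F j ⊛ G j)
  approx M = begin
    Π∞ F ⊛ Π∞ G                   ≈⟨ ⊛-cong-≈[] (Π∞-≈[]-Π≤ F-conv M) (Π∞-≈[]-Π≤ G-conv M) ⟩
    Π≤ M F ⊛ Π≤ M G               ≈⟨ ≈ₛ⇒≈[] (suc M) (Π≤-⊛ M F G) ⟩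
    Π≤ M (λ j → F j ⊛ G j)        ≈⟨ Π∞-≈[]-Π≤ (Convergent-⊛ F-conv G-conv) M ⟨
    Π∞ (λ j → F j ⊛ G j)          ∎
    where open ≈[]-Reasoning (suc M)

Π≤-even-odd : ∀ M F → Π≤ (suc (2 ℕ.* M)) F ≈ₛ (Π≤ M (λ i → F (2 ℕ.* i)) ⊛ Π≤ M (λ i → F (suc (2 ℕ.* i))))
Π≤-even-odd zero    F = ≈ₛ-refl
Π≤-even-odd (suc M) F = begin
  Π≤ (suc (2 ℕ.* suc M)) F                    ≈⟨ ≈ₛ-reflexive (cong (λ k → Π≤ (suc k) F) (ℕP.*-suc 2 M)) ⟩
  (Π≤ (suc (2 ℕ.* M)) F ⊛ F (2 ℕ.+ 2 ℕ.* M)) ⊛ F (3 ℕ.+ 2 ℕ.* M)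
    ≈⟨ ⊛-congʳ (F (3 ℕ.+ 2 ℕ.* M)) (⊛-congʳ (F (2 ℕ.+ 2 ℕ.* M)) (Π≤-even-odd M F)) ⟩
  ((E ⊛ O) ⊛ F (2 ℕ.+ 2 ℕ.* M)) ⊛ F (3 ℕ.+ 2 ℕ.* M)
    ≈⟨ ⊛-assoc (E ⊛ O) (F (2 ℕ.+ 2 ℕ.* M)) (F (3 ℕ.+ 2 ℕ.* M)) ⟩
  (E ⊛ O) ⊛ (F (2 ℕ.+ 2 ℕ.* M) ⊛ F (3 ℕ.+ 2 ℕ.* M))
    ≈⟨ interchange E O (F (2 ℕ.+ 2 ℕ.* M)) (F (3 ℕ.+ 2 ℕ.* M)) ⟩
  (E ⊛ F (2 ℕ.+ 2 ℕ.* M)) ⊛ (O ⊛ F (3 ℕ.+ 2 ℕ.* M))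
    ≈⟨ ≈ₛ-reflexive (cong (λ k → (E ⊛ F k) ⊛ (O ⊛ F (suc k))) (sym (ℕP.*-suc 2 M))) ⟩
  Π≤ (suc M) (λ i → F (2 ℕ.* i)) ⊛ Π≤ (suc M) (λ i → F (suc (2 ℕ.* i))) ∎
  where
  open ≈ₛ-Reasoning
  E = Π≤ M (λ i → F (2 ℕ.* i))
  O = Π≤ M (λ i → F (suc (2 ℕ.* i)))

Π∞-even-odd : ∀ {F} → Convergent F → Π∞ F ≈ₛ (Π∞ (λ i → F (2 ℕ.* i)) ⊛ Π∞ (λ i → F (suc (2 ℕ.* i))))
Π∞-even-odd {F} F-conv = ≈[]⇒≈ₛ approx
  where
  even-conv = Convergent-∘ F-conv (λ j → ℕP.m≤n*m j 2)
  odd-conv  = Convergent-∘ F-conv (λ j → ℕP.m≤n⇒m≤1+n (ℕP.m≤n*m j 2))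
  approx : ∀ M → Π∞ F ≈[ suc M ] (Π∞ (λ i → F (2 ℕ.* i)) ⊛ Π∞ (λ i → F (suc (2 ℕ.* i))))
  approx M = begin
    Π∞ F
      ≈⟨ ≈[]-weaken (s≤s (ℕP.m≤n⇒m≤1+n (ℕP.m≤n*m M 2))) (Π∞-≈[]-Π≤ F-conv (suc (2 ℕ.* M))) ⟩
    Π≤ (suc (2 ℕ.* M)) F
      ≈⟨ ≈ₛ⇒≈[] (suc M) (Π≤-even-odd M F) ⟩
    Π≤ M (λ i → F (2 ℕ.* i)) ⊛ Π≤ M (λ i → F (suc (2 ℕ.* i)))
      ≈⟨ ⊛-cong-≈[] (Π∞-≈[]-Π≤ even-conv M) (Π∞-≈[]-Π≤ odd-conv M) ⟨
    Π∞ (λ i → F (2 ℕ.* i)) ⊛ Π∞ (λ i → F (suc (2 ℕ.* i))) ∎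
    where open ≈[]-Reasoning (suc M)

qPochFactor : ℤ → ℕ → ℕ → ℕ → FPS
qPochFactor c a b j = qFactor c (a ℕ.+ b ℕ.* j)

qPoch-convergent : ∀ c {a b} → 1 ≤ a → 1 ≤ b → Convergent (qPochFactor c a b)
qPoch-convergent c {suc a} {suc b} _ _ j =
  ≈[]-weaken (s≤s (ℕP.≤-trans (ℕP.m≤n*m j (suc b)) (ℕP.m≤n+m _ a))) (qFactor-≈[]-1 c _)

qPoch-unfold : ∀ c {a b} → 1 ≤ a → 1 ≤ b → qPoch c a b ≈ₛ (qFactor c a ⊛ qPoch c (a ℕ.+ b) b)
qPoch-unfold c {a} {b} 1≤a 1≤b = ≈ₛ-trans (Π∞-suc (qPoch-convergent c 1≤a 1≤b))
  (⊛-cong (≈ₛ-reflexive (cong (qFactor c) (index₀ a b)))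
          (Π∞-cong λ j → ≈ₛ-reflexive (cong (qFactor c) (index-suc a b j))))
  where
  index₀ : ∀ a b → a ℕ.+ b ℕ.* 0 ≡ a
  index₀ = ℕ-solve-∀
  index-suc : ∀ a b j → a ℕ.+ b ℕ.* suc j ≡ (a ℕ.+ b) ℕ.+ b ℕ.* j
  index-suc = ℕ-solve-∀

qPoch-≈[]-1 : ∀ c a b → qPoch c a b ≈[ a ] X^ 0
qPoch-≈[]-1 c a b = Π∞-≈[]-1 (qPochFactor c a b) λ j → ≈[]-weaken (ℕP.m≤m+n a _) (qFactor-≈[]-1 c _)

qPoch-constant : ∀ c {a} b → 1 ≤ a → qPoch c a b 0 ≡ 1ℤ
qPoch-constant c {a} b 1≤a = qPoch-≈[]-1 c a b 0 1≤a

qFactor-conjugate : ∀ k → (qFactor -1ℤ k ⊛ qFactor 1ℤ k) ≈ₛ qFactor 1ℤ (k ℕ.+ k)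
qFactor-conjugate k = begin
  qFactor -1ℤ k ⊛ qFactor 1ℤ k                         ≈⟨ ⊛-cong (qFactor≈ -1ℤ k) (qFactor≈ 1ℤ k) ⟩
  (X^ 0 ⊖ (const -1ℤ ⊛ x)) ⊛ (X^ 0 ⊖ (const 1ℤ ⊛ x))   ≈⟨ prove ((Κ 1ℤ :- Κ -1ℤ :* X) :* (Κ 1ℤ :- Κ 1ℤ :* X))
                                                                 (Κ 1ℤ :- Κ 1ℤ :* (X :* X)) refl (x ∷ []) ⟩
  X^ 0 ⊖ (const 1ℤ ⊛ (x ⊛ x))                          ≈⟨ ⊖-congˡ (X^ 0) (⊛-congˡ (const 1ℤ) (X^-+ k k)) ⟨
  X^ 0 ⊖ (const 1ℤ ⊛ X^ (k ℕ.+ k))                     ≈⟨ qFactor≈ 1ℤ (k ℕ.+ k) ⟨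
  qFactor 1ℤ (k ℕ.+ k)                                 ∎
  where
  open ≈ₛ-Reasoning
  x = X^ k
  X = Ι zero

euler : (qPoch 1ℤ 1 2 ⊛ qPoch -1ℤ 1 1) ≈ₛ X^ 0
euler = ⊛-cancelʳ (qPoch 1ℤ 1 1) (qPoch-constant 1ℤ 1 ℕP.≤-refl) (begin
  (qPoch 1ℤ 1 2 ⊛ qPoch -1ℤ 1 1) ⊛ qPoch 1ℤ 1 1    ≈⟨ ⊛-assoc (qPoch 1ℤ 1 2) (qPoch -1ℤ 1 1) (qPoch 1ℤ 1 1) ⟩
  qPoch 1ℤ 1 2 ⊛ (qPoch -1ℤ 1 1 ⊛ qPoch 1ℤ 1 1)    ≈⟨ ⊛-congˡ (qPoch 1ℤ 1 2) conjugate-product ⟩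
  qPoch 1ℤ 1 2 ⊛ qPoch 1ℤ 2 2                      ≈⟨ odd-even-split ⟨
  qPoch 1ℤ 1 1                                     ≈⟨ ⊛-identityˡ (qPoch 1ℤ 1 1) ⟨
  X^ 0 ⊛ qPoch 1ℤ 1 1                              ∎)
  where
  open ≈ₛ-Reasoning
  conv : ∀ c → Convergent (qPochFactor c 1 1)
  conv c = qPoch-convergent c ℕP.≤-refl ℕP.≤-refl
  double : ∀ j → (1 ℕ.+ 1 ℕ.* j) ℕ.+ (1 ℕ.+ 1 ℕ.* j) ≡ 2 ℕ.+ 2 ℕ.* j
  double = ℕ-solve-∀
  even : ∀ i → 1 ℕ.+ 1 ℕ.* (2 ℕ.* i) ≡ 1 ℕ.+ 2 ℕ.* i
  even = ℕ-solve-∀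
  odd : ∀ i → 1 ℕ.+ 1 ℕ.* suc (2 ℕ.* i) ≡ 2 ℕ.+ 2 ℕ.* i
  odd = ℕ-solve-∀
  conjugate-product : (qPoch -1ℤ 1 1 ⊛ qPoch 1ℤ 1 1) ≈ₛ qPoch 1ℤ 2 2
  conjugate-product = ≈ₛ-trans (Π∞-⊛ (conv -1ℤ) (conv 1ℤ)) (Π∞-cong λ j →
    ≈ₛ-trans (qFactor-conjugate (1 ℕ.+ 1 ℕ.* j)) (≈ₛ-reflexive (cong (qFactor 1ℤ) (double j))))
  odd-even-split : qPoch 1ℤ 1 1 ≈ₛ (qPoch 1ℤ 1 2 ⊛ qPoch 1ℤ 2 2)
  odd-even-split = ≈ₛ-trans (Π∞-even-odd (conv 1ℤ))
    (⊛-cong (Π∞-cong λ i → ≈ₛ-reflexive (cong (qFactor 1ℤ) (even i)))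
            (Π∞-cong λ i → ≈ₛ-reflexive (cong (qFactor 1ℤ) (odd i))))

-- Polynomials and telescoping

𝐪 : ∀ {n} → Expr ℤ (suc n)
𝐪 = Ι zero

polyₑ : ∀ {n} → List ℤ → Expr ℤ (suc n)
polyₑ []       = Κ 0ℤ
polyₑ (c ∷ cs) = Κ c :+ 𝐪 :* polyₑ cs

poly₂ : List (List ℤ) → FPS → FPS
poly₂ []       y = 0ₛ
poly₂ (r ∷ rs) y = poly r ⊕ (y ⊛ poly₂ rs y)

poly₂ₑ : ∀ {n} → List (List ℤ) → Expr ℤ (suc n) → Expr ℤ (suc n)
poly₂ₑ []       y = Κ 0ℤ
poly₂ₑ (r ∷ rs) y = polyₑ r :+ y :* poly₂ₑ rs y

poly-eval : ∀ {n} L (ρ : Vec FPS n) → poly L ≈ₛ ⟦ polyₑ L ⟧ (q ∷ ρ)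
poly-eval []      ρ = 0ₛ≈const0
poly-eval (c ∷ L) ρ zero    = sym (ℤP.+-identityʳ c)
poly-eval (c ∷ L) ρ (suc N) =
  trans (poly-eval L ρ N) (trans (sym (q-⊛-suc (⟦ polyₑ L ⟧ (q ∷ ρ)) N)) (sym (ℤP.+-identityˡ _)))

poly₂-eval : ∀ {n} rs e (ρ : Vec FPS n) → poly₂ rs (⟦ e ⟧ (q ∷ ρ)) ≈ₛ ⟦ poly₂ₑ rs e ⟧ (q ∷ ρ)
poly₂-eval []       e ρ   = 0ₛ≈const0
poly₂-eval (r ∷ rs) e ρ N =
  cong₂ _+_ (poly-eval r ρ N) (⊛-congˡ (⟦ e ⟧ (q ∷ ρ)) (poly₂-eval rs e ρ) N)

poly₂-cong : ∀ rs {y y′} → y ≈ₛ y′ → poly₂ rs y ≈ₛ poly₂ rs y′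
poly₂-cong []       y≈y′ = ≈ₛ-refl
poly₂-cong (r ∷ rs) y≈y′ N = cong (λ z → poly r N + z) (⊛-cong y≈y′ (poly₂-cong rs y≈y′) N)

poly₂-≈[] : ∀ R {y K} → y ≈[ K ] 0ₛ → poly₂ R y ≈[ K ] poly₂ R 0ₛ
poly₂-≈[] []       y≈0 = λ _ _ → refl
poly₂-≈[] (r ∷ rs) {y} y≈0 N N<K = cong (λ z → poly r N + z)
  (trans (⊛-≈[]-0ˡ (poly₂ rs y) y≈0 N N<K) (sym (⊛-zeroˡ (poly₂ rs 0ₛ) N)))

sumSeries-cong : ∀ {F G} → (∀ n → F n ≈ₛ G n) → sumSeries F ≈ₛ sumSeries G
sumSeries-cong F≈G N = Σ≤-cong N (λ n _ → F≈G n N)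

partialSum : ℕ → (ℕ → FPS) → FPS
partialSum M F N = Σ≤ M (λ n → F n N)

sumSeries-≈[]-partialSum : ∀ {F} → (∀ n → F n ≈[ n ] 0ₛ) → ∀ M → sumSeries F ≈[ suc M ] partialSum M F
sumSeries-≈[]-partialSum {F} F-order M N (s≤s N≤M) = Σ≤-extend (λ n → F n N) N≤M (λ n N<n → F-order n N N<n)

telescope : ∀ {F G : ℕ → FPS} {D L : FPS}
  → (∀ n → (D ⊛ F n) ≈ₛ (G n ⊖ G (suc n)))
  → (∀ n → F n ≈[ n ] 0ₛ)
  → (∀ m → G (suc m) ≈[ suc m ] L)
  → (D ⊛ sumSeries F) ≈ₛ (G 0 ⊖ L)
telescope {F} {G} {D} {L} step F-order G-limit = ≈[]⇒≈ₛ approx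
  where
  telescoped : ∀ M → (D ⊛ partialSum M F) ≈ₛ (G 0 ⊖ G (suc M))
  telescoped zero    = step 0
  telescoped (suc M) N = trans (⊛-distribˡ-⊕ D (partialSum M F) (F (suc M)) N)
    (trans (cong₂ _+_ (telescoped M N) (step (suc M) N)) (collapse (G 0 N) (G (suc M) N) (G (suc (suc M)) N)))
    where
    collapse : ∀ a b c → (a - b) + (b - c) ≡ a - c
    collapse = solve-∀
  approx : ∀ M → (D ⊛ sumSeries F) ≈[ suc M ] (G 0 ⊖ L)
  approx M = begin
    D ⊛ sumSeries F       ≈⟨ ⊛-cong-≈[] {D} (λ _ _ → refl) (sumSeries-≈[]-partialSum F-order M) ⟩
    D ⊛ partialSum M F    ≈⟨ ≈ₛ⇒≈[] (suc M) (telescoped M) ⟩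
    G 0 ⊖ G (suc M)       ≈⟨ ⊖-cong-≈[] {G 0} (λ _ _ → refl) (G-limit M) ⟩
    G 0 ⊖ L               ∎
    where open ≈[]-Reasoning (suc M)

telescoping-step : ∀ {D w u v R R′ P P′} → v 0 ≡ 1ℤ
  → (P ⊛ v) ≈ₛ (u ⊛ P′)
  → ((D ⊛ w) ⊛ u) ≈ₛ ((R ⊛ u) ⊖ (R′ ⊛ v))
  → (D ⊛ (w ⊛ P)) ≈ₛ ((R ⊛ P) ⊖ (R′ ⊛ P′))
telescoping-step {D} {w} {u} {v} {R} {R′} {P} {P′} v₀≡1 ratio certificate = ⊛-cancelʳ v v₀≡1 (begin
  (D ⊛ (w ⊛ P)) ⊛ v                    ≈⟨ prove (𝐃 :* (𝐰 :* 𝐏) :* 𝐯) (𝐃 :* 𝐰 :* (𝐏 :* 𝐯)) refl ρ ⟩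
  (D ⊛ w) ⊛ (P ⊛ v)                    ≈⟨ ⊛-congˡ (D ⊛ w) ratio ⟩
  (D ⊛ w) ⊛ (u ⊛ P′)                   ≈⟨ ⊛-assoc (D ⊛ w) u P′ ⟨
  ((D ⊛ w) ⊛ u) ⊛ P′                   ≈⟨ ⊛-congʳ P′ certificate ⟩
  ((R ⊛ u) ⊖ (R′ ⊛ v)) ⊛ P′            ≈⟨ prove ((𝐑 :* 𝐮 :- 𝐑′ :* 𝐯) :* 𝐏′) (𝐑 :* (𝐮 :* 𝐏′) :- 𝐑′ :* 𝐏′ :* 𝐯) refl ρ ⟩
  (R ⊛ (u ⊛ P′)) ⊖ ((R′ ⊛ P′) ⊛ v)     ≈⟨ ⊖-congʳ ((R′ ⊛ P′) ⊛ v) (⊛-congˡ R ratio) ⟨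
  (R ⊛ (P ⊛ v)) ⊖ ((R′ ⊛ P′) ⊛ v)      ≈⟨ prove (𝐑 :* (𝐏 :* 𝐯) :- 𝐑′ :* 𝐏′ :* 𝐯) ((𝐑 :* 𝐏 :- 𝐑′ :* 𝐏′) :* 𝐯) refl ρ ⟩
  ((R ⊛ P) ⊖ (R′ ⊛ P′)) ⊛ v            ∎)
  where
  open ≈ₛ-Reasoning
  ρ = D ∷ w ∷ u ∷ v ∷ R ∷ R′ ∷ P ∷ P′ ∷ []
  𝐃 𝐰 𝐮 𝐯 𝐑 𝐑′ 𝐏 𝐏′ : Expr ℤ 8
  𝐃 = Ι zero
  𝐰 = Ι (suc zero)
  𝐮 = Ι (suc (suc zero))
  𝐯 = Ι (suc (suc (suc zero)))
  𝐑 = Ι (suc (suc (suc (suc zero))))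
  𝐑′ = Ι (suc (suc (suc (suc (suc zero)))))
  𝐏 = Ι (suc (suc (suc (suc (suc (suc zero))))))
  𝐏′ = Ι (suc (suc (suc (suc (suc (suc (suc zero)))))))

-- The two telescoping families

module PochhammerSum (c : ℤ) where

  A B C : ℕ → FPS
  A n = qPoch c (2 ℕ.* n ℕ.+ 6) 2
  B n = qPoch c (2 ℕ.* n ℕ.+ 2) 2
  C n = qPoch 1ℤ (2 ℕ.* n ℕ.+ 1) 2

  P : ℕ → FPS
  P n = (A n ⊛ B n) ⊘ sq (C n)

  term : ℕ → FPS
  term n = X^ (2 ℕ.* n ℕ.+ 1) ⊛ P n

  private
    1≤2n+ : ∀ n k → 1 ≤ 2 ℕ.* n ℕ.+ suc k
    1≤2n+ n k = ℕP.≤-trans (s≤s z≤n) (ℕP.m≤n+m (suc k) (2 ℕ.* n))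

    unfold : ∀ c′ n k → qPoch c′ (2 ℕ.* n ℕ.+ suc k) 2
                        ≈ₛ (qFactor c′ (2 ℕ.* n ℕ.+ suc k) ⊛ qPoch c′ (2 ℕ.* suc n ℕ.+ suc k) 2)
    unfold c′ n k = ≈ₛ-trans (qPoch-unfold c′ (1≤2n+ n k) (s≤s z≤n))
      (⊛-congˡ (qFactor c′ _) (≈ₛ-reflexive (cong (λ a → qPoch c′ a 2) (index n k))))
      where
      index : ∀ n k → (2 ℕ.* n ℕ.+ suc k) ℕ.+ 2 ≡ 2 ℕ.* suc n ℕ.+ suc k
      index = ℕ-solve-∀

    sq-C-constant : ∀ n → sq (C n) 0 ≡ 1ℤ
    sq-C-constant n = cong₂ ℤ._*_ h h where h = qPoch-constant 1ℤ 2 (1≤2n+ n 0)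

  P-ratio : ∀ n → (P n ⊛ sq (qFactor 1ℤ (2 ℕ.* n ℕ.+ 1)))
              ≈ₛ ((qFactor c (2 ℕ.* n ℕ.+ 2) ⊛ qFactor c (2 ℕ.* n ℕ.+ 6)) ⊛ P (suc n))
  P-ratio n = ⊘-shift {a′ = A (suc n) ⊛ B (suc n)} {α = f₂ ⊛ f₆} {b′ = sq (C (suc n))} {β = sq f₁}
    (sq-C-constant n) (sq-C-constant (suc n))
    (≈ₛ-trans (⊛-cong (unfold c n 5) (unfold c n 1))
              (≈ₛ-trans (interchange f₆ (A (suc n)) f₂ (B (suc n)))
                        (⊛-congʳ (A (suc n) ⊛ B (suc n)) (⊛-comm f₆ f₂))))
    (≈ₛ-trans (⊛-cong (unfold 1ℤ n 0) (unfold 1ℤ n 0)) (interchange f₁ (C (suc n)) f₁ (C (suc n))))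
    where
    f₁ = qFactor 1ℤ (2 ℕ.* n ℕ.+ 1)
    f₂ = qFactor c (2 ℕ.* n ℕ.+ 2)
    f₆ = qFactor c (2 ℕ.* n ℕ.+ 6)

  P-≈[]-1 : ∀ n → P n ≈[ suc (2 ℕ.* n) ] X^ 0
  P-≈[]-1 n =
    ⊛-≈[]-1 (⊛-≈[]-1 (≈1 c 5) (≈1 c 1)) (inv-≈[]-1 (sq-C-constant n) (⊛-≈[]-1 (≈1 1ℤ 0) (≈1 1ℤ 0)))
    where
    ≈1 : ∀ c′ k → qPoch c′ (2 ℕ.* n ℕ.+ suc k) 2 ≈[ suc (2 ℕ.* n) ] X^ 0
    ≈1 c′ k = ≈[]-weaken (ℕP.m<m+n (2 ℕ.* n) (s≤s z≤n)) (qPoch-≈[]-1 c′ _ 2)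

  term-order : ∀ n → term n ≈[ n ] 0ₛ
  term-order n = ≈[]-weaken (ℕP.≤-trans (ℕP.m≤n*m n 2) (ℕP.m≤m+n _ 1))
                            (⊛-≈[]-0ˡ (P n) (mono-≈[]-0 1ℤ (2 ℕ.* n ℕ.+ 1)))

  𝐲 : Expr ℤ 2
  𝐲 = Ι (suc zero)

  factorₑ : ℤ → ℕ → Expr ℤ 2
  factorₑ c′ k = Κ 1ℤ :- Κ c′ :* (𝐪 :^ k :* 𝐲)

  -- The two sides of the certificate identity of the header, with y standing for q^(2n).
  certificateₗ : List ℤ → Expr ℤ 2
  certificateₗ D = polyₑ D :* (𝐪 :* 𝐲) :* (factorₑ c 2 :* factorₑ c 6)

  certificateᵣ : List (List ℤ) → Expr ℤ 2
  certificateᵣ R =  poly₂ₑ R 𝐲 :* (factorₑ c 2 :* factorₑ c 6)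
                 :- poly₂ₑ R (𝐪 :^ 2 :* 𝐲) :* (factorₑ 1ℤ 1 :* factorₑ 1ℤ 1)

  module Certified (D : List ℤ) (Rs : List (List ℤ)) (identity : norm (certificateₗ D) ≡ norm (certificateᵣ Rs)) where

    R : ℕ → FPS
    R n = poly₂ Rs (X^ (2 ℕ.* n))

    G : ℕ → FPS
    G n = R n ⊛ P n

    certificate : ∀ n →
      ((poly D ⊛ X^ (2 ℕ.* n ℕ.+ 1)) ⊛ (qFactor c (2 ℕ.* n ℕ.+ 2) ⊛ qFactor c (2 ℕ.* n ℕ.+ 6)))
        ≈ₛ ((R n ⊛ (qFactor c (2 ℕ.* n ℕ.+ 2) ⊛ qFactor c (2 ℕ.* n ℕ.+ 6)))
            ⊖ (R (suc n) ⊛ sq (qFactor 1ℤ (2 ℕ.* n ℕ.+ 1))))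
    certificate n = begin
      _                              ≈⟨ ⊛-cong (⊛-cong (poly-eval D y) (X^-+-q^′ (2 ℕ.* n) 1))
                                               (⊛-cong (factor-eval c 2) (factor-eval c 6)) ⟩
      ⟦ certificateₗ D ⟧ ρ           ≈⟨ prove (certificateₗ D) (certificateᵣ Rs) identity ρ ⟩
      ⟦ certificateᵣ Rs ⟧ ρ          ≈⟨ ⊖-cong (⊛-cong (poly₂-eval Rs 𝐲 y) (⊛-cong (factor-eval c 2) (factor-eval c 6)))
                                               (⊛-cong R-suc (⊛-cong (factor-eval 1ℤ 1) (factor-eval 1ℤ 1))) ⟨
      _                              ∎
      where
      open ≈ₛ-Reasoning
      y = X^ (2 ℕ.* n) ∷ []
      ρ = q ∷ y
      factor-eval : ∀ c′ k → qFactor c′ (2 ℕ.* n ℕ.+ k) ≈ₛ ⟦ factorₑ c′ k ⟧ ρ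
      factor-eval c′ k = ≈ₛ-trans (qFactor≈ c′ _) (⊖-congˡ (X^ 0) (⊛-congˡ (const c′) (X^-+-q^′ (2 ℕ.* n) k)))
      R-suc : R (suc n) ≈ₛ ⟦ poly₂ₑ Rs (𝐪 :^ 2 :* 𝐲) ⟧ ρ
      R-suc = ≈ₛ-trans (poly₂-cong Rs (≈ₛ-trans (≈ₛ-reflexive (cong X^ (double-suc n))) (X^-+-q^′ (2 ℕ.* n) 2)))
                       (poly₂-eval Rs (𝐪 :^ 2 :* 𝐲) y)
        where
        double-suc : ∀ n → 2 ℕ.* suc n ≡ 2 ℕ.* n ℕ.+ 2
        double-suc = ℕ-solve-∀

    step : ∀ n → (poly D ⊛ term n) ≈ₛ (G n ⊖ G (suc n))
    step n = telescoping-step {poly D} {X^ (2 ℕ.* n ℕ.+ 1)} {f₂ ⊛ f₆} {sq f₁} {R n} {R (suc n)} {P n} {P (suc n)}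
      (cong₂ ℤ._*_ f₁-constant f₁-constant) (P-ratio n) (certificate n)
      where
      f₁ = qFactor 1ℤ (2 ℕ.* n ℕ.+ 1)
      f₂ = qFactor c (2 ℕ.* n ℕ.+ 2)
      f₆ = qFactor c (2 ℕ.* n ℕ.+ 6)
      f₁-constant = qFactor-≈[]-1 1ℤ (2 ℕ.* n ℕ.+ 1) 0 (1≤2n+ n 0)

    G-limit : ∀ m → G (suc m) ≈[ suc m ] poly₂ Rs 0ₛ
    G-limit m = begin
      R (suc m) ⊛ P (suc m)   ≈⟨ ⊛-cong-≈[] (≈[]-weaken (ℕP.m≤n*m (suc m) 2) (poly₂-≈[] Rs (mono-≈[]-0 1ℤ (2 ℕ.* suc m))))
                                            (≈[]-weaken (ℕP.m≤n⇒m≤1+n (ℕP.m≤n*m (suc m) 2)) (P-≈[]-1 (suc m))) ⟩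
      poly₂ Rs 0ₛ ⊛ X^ 0      ≈⟨ ≈ₛ⇒≈[] (suc m) (⊛-identityʳ (poly₂ Rs 0ₛ)) ⟩
      poly₂ Rs 0ₛ             ∎
      where open ≈[]-Reasoning (suc m)

    sum-telescopes : (poly D ⊛ sumSeries term) ≈ₛ ((poly₂ Rs (X^ 0) ⊛ P 0) ⊖ poly₂ Rs 0ₛ)
    sum-telescopes = telescope {term} {G} {poly D} step term-order G-limit

module CubicSum (s : ℤ) where

  coefficients : ℕ → List ℤ
  coefficients n = + (n ℕ.+ 1) ∷ s * + (n ℕ.+ 2) ∷ + (n ℕ.+ 3) ∷ []

  term : ℕ → FPS
  term n = ((s ^ n) · ((+ (n ℕ.+ 1)) · X^ (3 ℕ.* n ℕ.+ 1))) ⊛ poly (coefficients n)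

  ρ : ℕ → Vec FPS 4
  ρ n = q ∷ X^ (3 ℕ.* n) ∷ const (+ n) ∷ const (s ^ n) ∷ []

  𝐱 𝐦 𝛔 : Expr ℤ 4
  𝐱 = Ι (suc zero)
  𝐦 = Ι (suc (suc zero))
  𝛔 = Ι (suc (suc (suc zero)))

  termₑ : Expr ℤ 4
  termₑ = (𝛔 :* ((𝐦 :+ Κ 1ℤ) :* (𝐪 :* 𝐱)))
       :* ((𝐦 :+ Κ 1ℤ) :+ 𝐪 :* (Κ s :* (𝐦 :+ Κ (+ 2)) :+ 𝐪 :* ((𝐦 :+ Κ (+ 3)) :+ 𝐪 :* Κ 0ℤ)))

  term-eval : ∀ n → term n ≈ₛ ⟦ termₑ ⟧ (ρ n)
  term-eval n = ⊛-cong
    (≈ₛ-trans (≈ₛ-sym (const-⊛ (s ^ n) ((+ (n ℕ.+ 1)) · X^ (3 ℕ.* n ℕ.+ 1))))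
      (⊛-congˡ (const (s ^ n)) (≈ₛ-trans (≈ₛ-sym (const-⊛ (+ (n ℕ.+ 1)) (X^ (3 ℕ.* n ℕ.+ 1))))
                                         (⊛-cong (const-+ℕ n 1) (X^-+-q^′ (3 ℕ.* n) 1)))))
    (≈ₛ-trans (poly-eval (coefficients n) (X^ (3 ℕ.* n) ∷ const (+ n) ∷ const (s ^ n) ∷ []))
      (⊕-cong (const-+ℕ n 1)
        (⊛-congˡ q (⊕-cong (≈ₛ-trans (const-* s (+ (n ℕ.+ 2))) (⊛-congˡ (const s) (const-+ℕ n 2)))
                           (⊛-congˡ q (⊕-cong (const-+ℕ n 3) (≈ₛ-refl {q ⊛ const 0ℤ})))))))

  term-order : ∀ n → term n ≈[ n ] 0ₛ
  term-order n = ≈[]-weaken (ℕP.≤-trans (ℕP.m≤n*m n 3) (ℕP.m≤m+n _ 1))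
    (⊛-≈[]-0ˡ (poly (coefficients n)) (·-≈[]-0 (s ^ n) (·-≈[]-0 (+ (n ℕ.+ 1)) (mono-≈[]-0 1ℤ (3 ℕ.* n ℕ.+ 1)))))

  -- With x = q^(3n), m = n and σ = s^n this is  D(q) T = σ x h(q,m) - (s σ) (q³x) h(q,m+1).
  certificateₗ : List ℤ → Expr ℤ 4
  certificateₗ D = polyₑ D :* termₑ

  certificateᵣ : List (List ℤ) → Expr ℤ 4
  certificateᵣ h = 𝛔 :* (𝐱 :* poly₂ₑ h 𝐦) :- (Κ s :* 𝛔) :* ((𝐪 :^ 3 :* 𝐱) :* poly₂ₑ h (𝐦 :+ Κ 1ℤ))

  module Certified (D : List ℤ) (h : List (List ℤ)) (identity : norm (certificateₗ D) ≡ norm (certificateᵣ h)) where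

    H : ℕ → FPS
    H n = const (s ^ n) ⊛ (X^ (3 ℕ.* n) ⊛ poly₂ h (const (+ n)))

    step : ∀ n → (poly D ⊛ term n) ≈ₛ (H n ⊖ H (suc n))
    step n = begin
      poly D ⊛ term n                 ≈⟨ ⊛-cong (poly-eval D tail) (term-eval n) ⟩
      ⟦ certificateₗ D ⟧ (ρ n)        ≈⟨ prove (certificateₗ D) (certificateᵣ h) identity (ρ n) ⟩
      ⟦ certificateᵣ h ⟧ (ρ n)        ≈⟨ ⊖-cong (⊛-congˡ (const (s ^ n)) (⊛-congˡ (X^ (3 ℕ.* n)) (poly₂-eval h 𝐦 tail)))
                                                 (⊛-cong (const-* s (s ^ n)) (⊛-cong X^-3suc h-suc)) ⟨
      H n ⊖ H (suc n)                 ∎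
      where
      open ≈ₛ-Reasoning
      tail = X^ (3 ℕ.* n) ∷ const (+ n) ∷ const (s ^ n) ∷ []
      triple-suc : ∀ n → 3 ℕ.* suc n ≡ 3 ℕ.* n ℕ.+ 3
      triple-suc = ℕ-solve-∀
      X^-3suc : X^ (3 ℕ.* suc n) ≈ₛ (q ^′ 3 ⊛ X^ (3 ℕ.* n))
      X^-3suc = ≈ₛ-trans (≈ₛ-reflexive (cong X^ (triple-suc n))) (X^-+-q^′ (3 ℕ.* n) 3)
      h-suc : poly₂ h (const (+ suc n)) ≈ₛ ⟦ poly₂ₑ h (𝐦 :+ Κ 1ℤ) ⟧ (ρ n)
      h-suc = ≈ₛ-trans
        (poly₂-cong h (≈ₛ-trans (≈ₛ-reflexive (cong (λ k → const (+ k)) (ℕP.+-comm 1 n))) (const-+ℕ n 1)))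
        (poly₂-eval h (𝐦 :+ Κ 1ℤ) tail)

    H-limit : ∀ m → H (suc m) ≈[ suc m ] 0ₛ
    H-limit m = ≈[]-weaken (ℕP.m≤n*m (suc m) 3)
      (⊛-≈[]-0ʳ (const (s ^ suc m)) (⊛-≈[]-0ˡ (poly₂ h (const (+ suc m))) (mono-≈[]-0 1ℤ (3 ℕ.* suc m))))

    sum-telescopes : (poly D ⊛ sumSeries term) ≈ₛ (H 0 ⊖ 0ₛ)
    sum-telescopes = telescope {term} {H} {poly D} step term-order H-limit

    H₀-eval : (H 0 ⊖ 0ₛ) ≈ₛ ⟦ poly₂ₑ h (Κ 0ℤ) ⟧ (q ∷ [])
    H₀-eval N = begin
      (X^ 0 ⊛ (X^ 0 ⊛ h₀)) N + 0ℤ   ≡⟨ ℤP.+-identityʳ _ ⟩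
      (X^ 0 ⊛ (X^ 0 ⊛ h₀)) N        ≡⟨ ⊛-identityˡ (X^ 0 ⊛ h₀) N ⟩
      (X^ 0 ⊛ h₀) N                 ≡⟨ ⊛-identityˡ h₀ N ⟩
      h₀ N                          ≡⟨ poly₂-eval h (Κ 0ℤ) [] N ⟩
      ⟦ poly₂ₑ h (Κ 0ℤ) ⟧ (q ∷ []) N ∎
      where
      open ≡-Reasoning
      h₀ = poly₂ h (const 0ℤ)

-- The four identities

open ≈ₛ-Reasoning

poly-factorisation : ∀ a b D → norm (polyₑ a :* (polyₑ b :* polyₑ b)) ≡ norm (polyₑ D)
                   → (poly a ⊛ sq (poly b)) ≈ₛ poly D
poly-factorisation a b D eq = begin
  poly a ⊛ (poly b ⊛ poly b)                   ≈⟨ ⊛-cong (poly-eval a []) (⊛-cong (poly-eval b []) (poly-eval b [])) ⟩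
  ⟦ polyₑ a :* (polyₑ b :* polyₑ b) ⟧ (q ∷ [])  ≈⟨ prove (polyₑ a :* (polyₑ b :* polyₑ b)) (polyₑ D) eq (q ∷ []) ⟩
  ⟦ polyₑ D ⟧ (q ∷ [])                         ≈⟨ poly-eval D [] ⟨
  poly D                                       ∎

q-poly-identity : ∀ e L → norm e ≡ norm (𝐪 :* polyₑ L) → ⟦ e ⟧ (q ∷ []) ≈ₛ (X^ 1 ⊛ poly L)
q-poly-identity e L eq = ≈ₛ-trans (prove e (𝐪 :* polyₑ L) eq (q ∷ [])) (≈ₛ-sym (⊛-congˡ q (poly-eval L [])))

poly₂-at-0 : ∀ R → poly₂ R 0ₛ ≈ₛ ⟦ poly₂ₑ R (Κ 0ℤ) ⟧ (q ∷ [])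
poly₂-at-0 R = ≈ₛ-trans (poly₂-cong R 0ₛ≈const0) (poly₂-eval R (Κ 0ℤ) [])

-- D₁ = (1 - q)(1 - q³)² and D₃ = (1 + q)(1 + q³)²; a certificate R(q,y) = Σⱼ Rⱼ(q) yʲ, or
-- h(q,m) = Σⱼ hⱼ(q) mʲ, is listed by the coefficient lists of its Rⱼ or hⱼ.
D₁ D₃ N₁ N₃ : List ℤ
D₁ = 1ℤ ∷ -1ℤ ∷ 0ℤ ∷ - + 2 ∷ + 2 ∷ 0ℤ ∷ 1ℤ ∷ -1ℤ ∷ []
D₃ = 1ℤ ∷ 1ℤ ∷ 0ℤ ∷ + 2 ∷ + 2 ∷ 0ℤ ∷ 1ℤ ∷ 1ℤ ∷ []
N₁ = 1ℤ ∷ 1ℤ ∷ 1ℤ ∷ -1ℤ ∷ []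
N₃ = 1ℤ ∷ -1ℤ ∷ 1ℤ ∷ 1ℤ ∷ []

R₁ R₃ h₂ h₄ : List (List ℤ)
R₁ = (0ℤ ∷ -1ℤ ∷ -1ℤ ∷ -1ℤ ∷ 1ℤ ∷ [])
   ∷ (0ℤ ∷ 1ℤ ∷ 1ℤ ∷ + 2 ∷ 0ℤ ∷ 1ℤ ∷ 1ℤ ∷ 1ℤ ∷ -1ℤ ∷ [])
   ∷ (0ℤ ∷ 0ℤ ∷ 0ℤ ∷ -1ℤ ∷ -1ℤ ∷ -1ℤ ∷ -1ℤ ∷ - + 2 ∷ [])
   ∷ (0ℤ ∷ 0ℤ ∷ 0ℤ ∷ 0ℤ ∷ 0ℤ ∷ 0ℤ ∷ 0ℤ ∷ 1ℤ ∷ 1ℤ ∷ [])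
   ∷ []
R₃ = (0ℤ ∷ 1ℤ ∷ -1ℤ ∷ 1ℤ ∷ 1ℤ ∷ [])
   ∷ (0ℤ ∷ 1ℤ ∷ -1ℤ ∷ + 2 ∷ 0ℤ ∷ 1ℤ ∷ -1ℤ ∷ 1ℤ ∷ 1ℤ ∷ [])
   ∷ (0ℤ ∷ 0ℤ ∷ 0ℤ ∷ 1ℤ ∷ -1ℤ ∷ 1ℤ ∷ -1ℤ ∷ + 2 ∷ [])
   ∷ (0ℤ ∷ 0ℤ ∷ 0ℤ ∷ 0ℤ ∷ 0ℤ ∷ 0ℤ ∷ 0ℤ ∷ 1ℤ ∷ -1ℤ ∷ [])
   ∷ []
h₂ = (0ℤ ∷ 1ℤ ∷ 1ℤ ∷ 1ℤ ∷ -1ℤ ∷ [])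
   ∷ (0ℤ ∷ + 2 ∷ 1ℤ ∷ 1ℤ ∷ - + 4 ∷ -1ℤ ∷ -1ℤ ∷ + 2 ∷ [])
   ∷ (0ℤ ∷ 1ℤ ∷ 0ℤ ∷ 0ℤ ∷ - + 2 ∷ 0ℤ ∷ 0ℤ ∷ 1ℤ ∷ [])
   ∷ []
h₄ = (0ℤ ∷ 1ℤ ∷ -1ℤ ∷ 1ℤ ∷ 1ℤ ∷ [])
   ∷ (0ℤ ∷ + 2 ∷ -1ℤ ∷ 1ℤ ∷ + 4 ∷ -1ℤ ∷ 1ℤ ∷ + 2 ∷ [])
   ∷ (0ℤ ∷ 1ℤ ∷ 0ℤ ∷ 0ℤ ∷ + 2 ∷ 0ℤ ∷ 0ℤ ∷ 1ℤ ∷ [])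
   ∷ []

module Sum₁ = PochhammerSum.Certified 1ℤ D₁ R₁ refl
module Sum₂ = CubicSum.Certified 1ℤ D₁ h₂ refl
module Sum₃ = PochhammerSum.Certified -1ℤ D₃ R₃ refl
module Sum₄ = CubicSum.Certified -1ℤ D₃ h₄ refl

denominator₁ denominator₃ : FPS
denominator₁ = poly (1ℤ ∷ -1ℤ ∷ []) ⊛ sq (poly (1ℤ ∷ 0ℤ ∷ 0ℤ ∷ -1ℤ ∷ []))
denominator₃ = poly (1ℤ ∷ 1ℤ ∷ []) ⊛ sq (poly (1ℤ ∷ 0ℤ ∷ 0ℤ ∷ 1ℤ ∷ []))

denominator₁≈D₁ : denominator₁ ≈ₛ poly D₁
denominator₁≈D₁ = poly-factorisation (1ℤ ∷ -1ℤ ∷ []) (1ℤ ∷ 0ℤ ∷ 0ℤ ∷ -1ℤ ∷ []) D₁ refl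

denominator₃≈D₃ : denominator₃ ≈ₛ poly D₃
denominator₃≈D₃ = poly-factorisation (1ℤ ∷ 1ℤ ∷ []) (1ℤ ∷ 0ℤ ∷ 0ℤ ∷ 1ℤ ∷ []) D₃ refl

first-sum-closed-form : sumSeries (PochhammerSum.term 1ℤ) ≈ₛ ((X^ 1 ⊛ poly N₁) ⊘ denominator₁)
first-sum-closed-form = ⊘-unique denominator₁ refl (begin
  S ⊛ denominator₁                          ≈⟨ ⊛-congˡ S denominator₁≈D₁ ⟩
  S ⊛ poly D₁                               ≈⟨ ⊛-comm S (poly D₁) ⟩
  poly D₁ ⊛ S                               ≈⟨ Sum₁.sum-telescopes ⟩
  (poly₂ R₁ (X^ 0) ⊛ P 0) ⊖ poly₂ R₁ 0ₛ    ≈⟨ ⊖-cong G₀-vanishes (poly₂-at-0 R₁) ⟩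
  ⟦ Κ 0ℤ :- poly₂ₑ R₁ (Κ 0ℤ) ⟧ (q ∷ [])     ≈⟨ q-poly-identity (Κ 0ℤ :- poly₂ₑ R₁ (Κ 0ℤ)) N₁ refl ⟩
  X^ 1 ⊛ poly N₁                            ∎)
  where
  open PochhammerSum 1ℤ using (term; P)
  S = sumSeries term
  G₀-vanishes : (poly₂ R₁ (X^ 0) ⊛ P 0) ≈ₛ const 0ℤ
  G₀-vanishes = begin
    poly₂ R₁ (X^ 0) ⊛ P 0                   ≈⟨ ⊛-congʳ (P 0) (poly₂-eval R₁ (Κ 1ℤ) []) ⟩
    ⟦ poly₂ₑ R₁ (Κ 1ℤ) ⟧ (q ∷ []) ⊛ P 0     ≈⟨ ⊛-congʳ (P 0) (prove (poly₂ₑ R₁ (Κ 1ℤ)) (Κ 0ℤ) refl (q ∷ [])) ⟩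
    const 0ℤ ⊛ P 0                          ≈⟨ ⊛-congʳ (P 0) 0ₛ≈const0 ⟨
    0ₛ ⊛ P 0                                ≈⟨ ⊛-zeroˡ (P 0) ⟩
    0ₛ                                      ≈⟨ 0ₛ≈const0 ⟩
    const 0ℤ                                ∎

first-rational-expansion :
  ((X^ 1 ⊛ poly N₁) ⊘ denominator₁)
    ≈ₛ sumSeries (λ n → ((+ (n ℕ.+ 1)) · X^ (3 ℕ.* n ℕ.+ 1)) ⊛ poly (+ (n ℕ.+ 1) ∷ + (n ℕ.+ 2) ∷ + (n ℕ.+ 3) ∷ []))
first-rational-expansion = ≈ₛ-sym (⊘-unique denominator₁ refl (begin
  sumSeries T ⊛ denominator₁      ≈⟨ ⊛-cong (sumSeries-cong T≈term) denominator₁≈D₁ ⟩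
  sumSeries term ⊛ poly D₁        ≈⟨ ⊛-comm (sumSeries term) (poly D₁) ⟩
  poly D₁ ⊛ sumSeries term        ≈⟨ Sum₂.sum-telescopes ⟩
  Sum₂.H 0 ⊖ 0ₛ                   ≈⟨ Sum₂.H₀-eval ⟩
  ⟦ poly₂ₑ h₂ (Κ 0ℤ) ⟧ (q ∷ [])   ≈⟨ q-poly-identity (poly₂ₑ h₂ (Κ 0ℤ)) N₁ refl ⟩
  X^ 1 ⊛ poly N₁                  ∎))
  where
  open CubicSum 1ℤ using (term)
  T : ℕ → FPS
  T n = ((+ (n ℕ.+ 1)) · X^ (3 ℕ.* n ℕ.+ 1)) ⊛ poly (+ (n ℕ.+ 1) ∷ + (n ℕ.+ 2) ∷ + (n ℕ.+ 3) ∷ [])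
  T≈term : ∀ n → T n ≈ₛ term n
  T≈term n = ⊛-cong (λ N → sym (trans (cong (ℤ._* f N) (ℤP.^-zeroˡ n)) (ℤP.*-identityˡ (f N))))
                    (≈ₛ-reflexive (cong (λ c → poly (+ (n ℕ.+ 1) ∷ c ∷ + (n ℕ.+ 3) ∷ [])) (sym (ℤP.*-identityˡ _))))
    where f = (+ (n ℕ.+ 1)) · X^ (3 ℕ.* n ℕ.+ 1)

E a₀ b₀ d₀ : FPS
E  = qPoch -1ℤ 2 1
a₀ = qPoch -1ℤ 6 2
b₀ = qPoch -1ℤ 2 2
d₀ = qPoch 1ℤ 1 2

p₂ p₃ p₄ c₃ : List ℤ
p₂ = 1ℤ ∷ 0ℤ ∷ 1ℤ ∷ []
p₃ = 1ℤ ∷ -1ℤ ∷ + 2 ∷ []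
p₄ = 1ℤ ∷ 1ℤ ∷ []
c₃ = 1ℤ ∷ 0ℤ ∷ 0ℤ ∷ 1ℤ ∷ []

A₃ B₃ : FPS
A₃ = (+ 2) · X^ 1 ⊛ sq E ⊛ sq b₀ ⊛ (poly p₃ ⊛ poly p₄) ⊘ (poly p₂ ⊛ sq (poly c₃))
B₃ = (X^ 1 ⊛ poly N₃) ⊘ denominator₃

euler-unfolded : (d₀ ⊛ (qFactor -1ℤ 1 ⊛ E)) ≈ₛ X^ 0
euler-unfolded = ≈ₛ-trans (⊛-congˡ d₀ (≈ₛ-sym (qPoch-unfold -1ℤ ℕP.≤-refl ℕP.≤-refl))) euler

P₀-product : PochhammerSum.P -1ℤ 0 ≈ₛ ((a₀ ⊛ b₀) ⊛ sq (qFactor -1ℤ 1 ⊛ E))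
P₀-product = ⊘-inverse (a₀ ⊛ b₀) {g′ = sq f} refl (begin
  sq d₀ ⊛ sq f          ≈⟨ interchange d₀ d₀ f f ⟩
  sq (d₀ ⊛ f)           ≈⟨ ⊛-cong euler-unfolded euler-unfolded ⟩
  X^ 0 ⊛ X^ 0           ≈⟨ ⊛-identityˡ (X^ 0) ⟩
  X^ 0                  ∎)
  where f = qFactor -1ℤ 1 ⊛ E

b₀-unfold : b₀ ≈ₛ (qFactor -1ℤ 2 ⊛ (qFactor -1ℤ 4 ⊛ a₀))
b₀-unfold = ≈ₛ-trans (qPoch-unfold -1ℤ {2} {2} (s≤s z≤n) (s≤s z≤n))
  (⊛-congˡ (qFactor -1ℤ 2) (qPoch-unfold -1ℤ {4} {2} (s≤s z≤n) (s≤s z≤n)))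

-- With b₀ = (1 + q²)(1 + q⁴) a₀ and Euler's (q;q²)∞⁻¹ = (1 + q)(-q²;q)∞ both sides are polynomials
-- in q, E and a₀; they agree because R₃(q,1) = 2q (1 + q⁴)(1 - q + 2q²).
A₃-D₃ : (A₃ ⊛ poly D₃) ≈ₛ (poly₂ R₃ (X^ 0) ⊛ PochhammerSum.P -1ℤ 0)
A₃-D₃ = ⊛-cancelʳ den refl (begin
  (A₃ ⊛ poly D₃) ⊛ den                   ≈⟨ xy∙z≈xz∙y A₃ (poly D₃) den ⟩
  (A₃ ⊛ den) ⊛ poly D₃                   ≈⟨ ⊛-congʳ (poly D₃) (⊘-⊛-cancel num refl) ⟩
  num ⊛ poly D₃                          ≈⟨ ⊛-cong num-eval (poly-eval D₃ ρ′) ⟩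
  ⟦ numₑ :* polyₑ D₃ ⟧ ρ                 ≈⟨ prove (numₑ :* polyₑ D₃) (poly₂ₑ R₃ (Κ 1ℤ) :* P₀ₑ :* denₑ) refl ρ ⟩
  ⟦ poly₂ₑ R₃ (Κ 1ℤ) :* P₀ₑ :* denₑ ⟧ ρ  ≈⟨ ⊛-cong (⊛-cong (poly₂-eval R₃ (Κ 1ℤ) ρ′) P₀-eval) den-eval ⟨
  (poly₂ R₃ (X^ 0) ⊛ P 0) ⊛ den          ∎)
  where
  open PochhammerSum -1ℤ using (P)
  num den : FPS
  num = (+ 2) · X^ 1 ⊛ sq E ⊛ sq b₀ ⊛ (poly p₃ ⊛ poly p₄)
  den = poly p₂ ⊛ sq (poly c₃)
  ρ′ = E ∷ a₀ ∷ []
  ρ = q ∷ ρ′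
  𝐄 𝐚 : Expr ℤ 3
  𝐄 = Ι (suc zero)
  𝐚 = Ι (suc (suc zero))
  factorₑ : ℕ → Expr ℤ 3
  factorₑ k = Κ 1ℤ :- Κ -1ℤ :* (𝐪 :^ k)
  factor-eval : ∀ k → qFactor -1ℤ k ≈ₛ ⟦ factorₑ k ⟧ ρ
  factor-eval k = ≈ₛ-trans (qFactor≈ -1ℤ k) (⊖-congˡ (X^ 0) (⊛-congˡ (const -1ℤ) (X^≈q^′ k)))
  𝐛 numₑ denₑ P₀ₑ : Expr ℤ 3
  𝐛 = factorₑ 2 :* (factorₑ 4 :* 𝐚)
  numₑ = Κ (+ 2) :* 𝐪 :* (𝐄 :* 𝐄) :* (𝐛 :* 𝐛) :* (polyₑ p₃ :* polyₑ p₄)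
  denₑ = polyₑ p₂ :* (polyₑ c₃ :* polyₑ c₃)
  P₀ₑ = (𝐚 :* 𝐛) :* ((factorₑ 1 :* 𝐄) :* (factorₑ 1 :* 𝐄))
  b-eval : b₀ ≈ₛ ⟦ 𝐛 ⟧ ρ
  b-eval = ≈ₛ-trans b₀-unfold (⊛-cong (factor-eval 2) (⊛-congʳ a₀ (factor-eval 4)))
  num-eval : num ≈ₛ ⟦ numₑ ⟧ ρ
  num-eval = ⊛-cong (⊛-cong (⊛-congʳ (sq E) (≈ₛ-sym (const-⊛ (+ 2) q))) (⊛-cong b-eval b-eval))
                    (⊛-cong (poly-eval p₃ ρ′) (poly-eval p₄ ρ′))
  den-eval : den ≈ₛ ⟦ denₑ ⟧ ρ
  den-eval = ⊛-cong (poly-eval p₂ ρ′) (⊛-cong (poly-eval c₃ ρ′) (poly-eval c₃ ρ′))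
  P₀-eval : P 0 ≈ₛ ⟦ P₀ₑ ⟧ ρ
  P₀-eval = ≈ₛ-trans P₀-product (⊛-cong (⊛-congˡ a₀ b-eval) (⊛-cong fE fE))
    where fE = ⊛-congʳ E (factor-eval 1)

B₃-D₃ : (B₃ ⊛ poly D₃) ≈ₛ poly₂ R₃ 0ₛ
B₃-D₃ = begin
  B₃ ⊛ poly D₃                   ≈⟨ ⊛-congˡ B₃ denominator₃≈D₃ ⟨
  B₃ ⊛ denominator₃              ≈⟨ ⊘-⊛-cancel (X^ 1 ⊛ poly N₃) refl ⟩
  X^ 1 ⊛ poly N₃                 ≈⟨ q-poly-identity (poly₂ₑ R₃ (Κ 0ℤ)) N₃ refl ⟨
  ⟦ poly₂ₑ R₃ (Κ 0ℤ) ⟧ (q ∷ [])  ≈⟨ poly₂-at-0 R₃ ⟨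
  poly₂ R₃ 0ₛ                    ∎

second-sum-closed-form : sumSeries (PochhammerSum.term -1ℤ) ≈ₛ (A₃ ⊖ B₃)
second-sum-closed-form = ⊛-cancelʳ (poly D₃) refl (begin
  S ⊛ poly D₃                               ≈⟨ ⊛-comm S (poly D₃) ⟩
  poly D₃ ⊛ S                               ≈⟨ Sum₃.sum-telescopes ⟩
  (poly₂ R₃ (X^ 0) ⊛ P 0) ⊖ poly₂ R₃ 0ₛ    ≈⟨ ⊖-cong A₃-D₃ B₃-D₃ ⟨
  (A₃ ⊛ poly D₃) ⊖ (B₃ ⊛ poly D₃)           ≈⟨ ⊛-distribʳ-⊖ A₃ B₃ (poly D₃) ⟨
  (A₃ ⊖ B₃) ⊛ poly D₃                       ∎)
  where
  open PochhammerSum -1ℤ using (term; P)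
  S = sumSeries term

second-rational-expansion :
  B₃ ≈ₛ sumSeries (λ n → ((-1ℤ ^ n) · ((+ (n ℕ.+ 1)) · X^ (3 ℕ.* n ℕ.+ 1)))
                         ⊛ poly (+ (n ℕ.+ 1) ∷ - (+ (n ℕ.+ 2)) ∷ + (n ℕ.+ 3) ∷ []))
second-rational-expansion = ≈ₛ-sym (⊘-unique denominator₃ refl (begin
  sumSeries T ⊛ denominator₃      ≈⟨ ⊛-cong (sumSeries-cong T≈term) denominator₃≈D₃ ⟩
  sumSeries term ⊛ poly D₃        ≈⟨ ⊛-comm (sumSeries term) (poly D₃) ⟩
  poly D₃ ⊛ sumSeries term        ≈⟨ Sum₄.sum-telescopes ⟩
  Sum₄.H 0 ⊖ 0ₛ                   ≈⟨ Sum₄.H₀-eval ⟩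
  ⟦ poly₂ₑ h₄ (Κ 0ℤ) ⟧ (q ∷ [])   ≈⟨ q-poly-identity (poly₂ₑ h₄ (Κ 0ℤ)) N₃ refl ⟩
  X^ 1 ⊛ poly N₃                  ∎))
  where
  open CubicSum -1ℤ using (term)
  t : ℕ → FPS
  t n = (-1ℤ ^ n) · ((+ (n ℕ.+ 1)) · X^ (3 ℕ.* n ℕ.+ 1))
  T : ℕ → FPS
  T n = t n ⊛ poly (+ (n ℕ.+ 1) ∷ - (+ (n ℕ.+ 2)) ∷ + (n ℕ.+ 3) ∷ [])
  T≈term : ∀ n → T n ≈ₛ term n
  T≈term n = ≈ₛ-reflexive (cong (λ c → t n ⊛ poly (+ (n ℕ.+ 1) ∷ c ∷ + (n ℕ.+ 3) ∷ [])) (sym (ℤP.-1*i≡-i _)))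

corollary3 :
    (sumSeries (λ n → X^ (2 ℕ.* n ℕ.+ 1)
        ⊛ ((qPoch 1ℤ (2 ℕ.* n ℕ.+ 6) 2 ⊛ qPoch 1ℤ (2 ℕ.* n ℕ.+ 2) 2)
           ⊘ sq (qPoch 1ℤ (2 ℕ.* n ℕ.+ 1) 2)))
      ≈ₛ ((X^ 1 ⊛ poly (1ℤ ∷ 1ℤ ∷ 1ℤ ∷ -1ℤ ∷ []))
           ⊘ (poly (1ℤ ∷ -1ℤ ∷ []) ⊛ sq (poly (1ℤ ∷ 0ℤ ∷ 0ℤ ∷ -1ℤ ∷ [])))))
    × (((X^ 1 ⊛ poly (1ℤ ∷ 1ℤ ∷ 1ℤ ∷ -1ℤ ∷ []))
           ⊘ (poly (1ℤ ∷ -1ℤ ∷ []) ⊛ sq (poly (1ℤ ∷ 0ℤ ∷ 0ℤ ∷ -1ℤ ∷ []))))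
      ≈ₛ sumSeries (λ n → ((+ (n ℕ.+ 1)) · X^ (3 ℕ.* n ℕ.+ 1))
           ⊛ poly (+ (n ℕ.+ 1) ∷ + (n ℕ.+ 2) ∷ + (n ℕ.+ 3) ∷ [])))
    × (sumSeries (λ n → X^ (2 ℕ.* n ℕ.+ 1)
        ⊛ ((qPoch -1ℤ (2 ℕ.* n ℕ.+ 6) 2 ⊛ qPoch -1ℤ (2 ℕ.* n ℕ.+ 2) 2)
           ⊘ sq (qPoch 1ℤ (2 ℕ.* n ℕ.+ 1) 2)))
      ≈ₛ (((+ 2) · X^ 1 ⊛ sq (qPoch -1ℤ 2 1) ⊛ sq (qPoch -1ℤ 2 2)
             ⊛ (poly (1ℤ ∷ -1ℤ ∷ + 2 ∷ []) ⊛ poly (1ℤ ∷ 1ℤ ∷ []))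
             ⊘ (poly (1ℤ ∷ 0ℤ ∷ 1ℤ ∷ []) ⊛ sq (poly (1ℤ ∷ 0ℤ ∷ 0ℤ ∷ 1ℤ ∷ []))))
          ⊖ ((X^ 1 ⊛ poly (1ℤ ∷ -1ℤ ∷ 1ℤ ∷ 1ℤ ∷ []))
             ⊘ (poly (1ℤ ∷ 1ℤ ∷ []) ⊛ sq (poly (1ℤ ∷ 0ℤ ∷ 0ℤ ∷ 1ℤ ∷ []))))))
    × ((((+ 2) · X^ 1 ⊛ sq (qPoch -1ℤ 2 1) ⊛ sq (qPoch -1ℤ 2 2)
             ⊛ (poly (1ℤ ∷ -1ℤ ∷ + 2 ∷ []) ⊛ poly (1ℤ ∷ 1ℤ ∷ []))
             ⊘ (poly (1ℤ ∷ 0ℤ ∷ 1ℤ ∷ []) ⊛ sq (poly (1ℤ ∷ 0ℤ ∷ 0ℤ ∷ 1ℤ ∷ []))))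
          ⊖ ((X^ 1 ⊛ poly (1ℤ ∷ -1ℤ ∷ 1ℤ ∷ 1ℤ ∷ []))
             ⊘ (poly (1ℤ ∷ 1ℤ ∷ []) ⊛ sq (poly (1ℤ ∷ 0ℤ ∷ 0ℤ ∷ 1ℤ ∷ [])))))
      ≈ₛ (((+ 2) · X^ 1 ⊛ sq (qPoch -1ℤ 2 1) ⊛ sq (qPoch -1ℤ 2 2)
             ⊛ (poly (1ℤ ∷ -1ℤ ∷ + 2 ∷ []) ⊛ poly (1ℤ ∷ 1ℤ ∷ []))
             ⊘ (poly (1ℤ ∷ 0ℤ ∷ 1ℤ ∷ []) ⊛ sq (poly (1ℤ ∷ 0ℤ ∷ 0ℤ ∷ 1ℤ ∷ []))))
          ⊖ sumSeries (λ n → ((-1ℤ ^ n) · ((+ (n ℕ.+ 1)) · X^ (3 ℕ.* n ℕ.+ 1)))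
             ⊛ poly (+ (n ℕ.+ 1) ∷ - (+ (n ℕ.+ 2)) ∷ + (n ℕ.+ 3) ∷ []))))
corollary3 =
    first-sum-closed-form
  , first-rational-expansion
  , second-sum-closed-form
  , ⊖-congˡ A₃ second-rational-expansion
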